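{- Let $q$ be a prime power, $n\ge 2$, $0\le h\le n-2$, $k\ge1$, and let $B\in\mathbb F_q[T]$ be monic with $\deg(B)=n-h-1$. Then \[\mathcal{N}^U_{0,\Lambda_k}(T^{h+1}B;h)=\tilde{\Psi}_k(n;T^{n-h},B^*).\]
   Context: $|g|=q^{\deg g}$ ($|0|=0$). $\Lambda(f)=\deg P$ if $f=P^j$ with $P$ monic irreducible, $j\ge1$, and $0$ otherwise; for monic $f$, $\Lambda_k(f)=\sum_{f_1\cdots f_k=f,\ f_i\text{ monic}}\Lambda(f_1)\cdots\Lambda(f_k)$, and $\Lambda_k(cf):=\Lambda_k(f)$ for $c\in\mathbb F_q^\times$. For monic $A$ of degree $n$, $\mathcal N^U_{0,\Lambda_k}(A;h)=\sum_{f\text{ monic},\ |f-A|\le q^h,\ f(0)\ne0}\Lambda_k(f)$. For $Q,A\in\mathbb F_q[T]$, $\tilde\Psi_k(n;Q,A)=\sum_{\deg f=n,\ f\equiv A\pmod Q}\Lambda_k(f)$, the sum over all (not necessarily monic) polynomials $f$ of degree exactly $n$. For nonzero $g\in\mathbb F_q[T]$, $g^*(T)=T^{\deg g}g(1/T)$. -}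

module Defs where

open import Level using (0ℓ)
open import Data.Bool using (Bool; true; false; _∧_; _∨_; not; if_then_else_)
open import Data.Nat as ℕ using (ℕ; zero; suc; _∸_; _≤ᵇ_)
open import Data.List using (List; []; _∷_; _++_; map; concatMap; reverse; length; upTo; foldr; replicate)
open import Data.List.Properties using (≡-dec)
open import Data.List.Membership.Propositional using (_∈_)
open import Data.List.Relation.Unary.Unique.Propositional using (Unique)
open import Data.Product using (_×_; _,_)
open import Relation.Nullary using (¬_; ⌊_⌋)
open import Relation.Binary.PropositionalEquality using (_≡_)
open import Relation.Binary.Definitions using (DecidableEquality)
open import Algebra.Structures using (IsCommutativeRing)

-- A finite field F_q.  (Every finite field has prime-power order q and
-- every prime power q is the order of a finite field, so quantifying over
-- all finite fields is the same as quantifying over all F_q, q a prime power.)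

record FiniteField : Set₁ where
  field
    Carrier : Set
    _≟_     : DecidableEquality Carrier
    _+_ _*_ : Carrier → Carrier → Carrier
    -_      : Carrier → Carrier
    0# 1#   : Carrier
    _⁻¹     : Carrier → Carrier
    isCommutativeRing : IsCommutativeRing _≡_ _+_ _*_ -_ 0# 1#
    0≢1     : ¬ (0# ≡ 1#)
    inverseʳ : ∀ x → ¬ (x ≡ 0#) → x * (x ⁻¹) ≡ 1#
    elements : List Carrier
    complete : ∀ x → x ∈ elements
    unique   : Unique elements

  q : ℕ
  q = length elements

-- Polynomials over F as coefficient lists, lowest degree first.
-- All operations return the normal form (no trailing zero coefficients);
-- the zero polynomial is [].

module Poly (F : FiniteField) where
  open FiniteField F

  Pol : Set
  Pol = List Carrier

  isZ : Carrier → Bool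
  isZ a = ⌊ a ≟ 0# ⌋

  strip : Pol → Pol
  strip = foldr step []
    where
    step : Carrier → Pol → Pol
    step a [] = if isZ a then [] else a ∷ []
    step a (b ∷ bs) = a ∷ b ∷ bs

  _==_ : Pol → Pol → Bool
  p == r = ⌊ ≡-dec _≟_ (strip p) (strip r) ⌋

  addL : Pol → Pol → Pol
  addL [] r = r
  addL (a ∷ p) [] = a ∷ p
  addL (a ∷ p) (b ∷ r) = (a + b) ∷ addL p r

  scaleL : Carrier → Pol → Pol
  scaleL c = map (c *_)

  mulL : Pol → Pol → Pol
  mulL [] r = []
  mulL (a ∷ p) r = addL (scaleL a r) (0# ∷ mulL p r)

  _⊕_ _⊖_ _⊗_ : Pol → Pol → Pol
  p ⊕ r = strip (addL p r)
  p ⊖ r = strip (addL p (map -_ r))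
  p ⊗ r = strip (mulL p r)

  one : Pol
  one = 1# ∷ []

  T^ : ℕ → Pol
  T^ m = replicate m 0# ++ (1# ∷ [])

  _^P_ : Pol → ℕ → Pol
  p ^P zero = one
  p ^P suc j = p ⊗ (p ^P j)

  prodP : List Pol → Pol
  prodP = foldr _⊗_ one

  -- degree (deg 0 := 0; only used together with the separate zero test)
  deg : Pol → ℕ
  deg p = length (strip p) ∸ 1

  lastC : Pol → Carrier
  lastC [] = 0#
  lastC (a ∷ []) = a
  lastC (a ∷ b ∷ p) = lastC (b ∷ p)

  lead : Pol → Carrier
  lead p = lastC (strip p)

  isMonic : Pol → Set
  isMonic p = ((p == []) ≡ false) × (lead p ≡ 1#)

  ∣_∣ : Pol → ℕ
  ∣ g ∣ with strip g
  ... | [] = 0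
  ... | _ ∷ _ = q ℕ.^ deg g

  at0 : Pol → Carrier
  at0 p with strip p
  ... | [] = 0#
  ... | a ∷ _ = a

  -- g*(T) = T^{deg g} g(1/T) : reverse the coefficient list
  _* : Pol → Pol
  g * = strip (reverse (strip g))

  monicize : Pol → Pol
  monicize f = strip (scaleL (lead f ⁻¹) f)

  filterᵇ : {A : Set} → (A → Bool) → List A → List A
  filterᵇ P [] = []
  filterᵇ P (x ∷ xs) = if P x then x ∷ filterᵇ P xs else filterᵇ P xs

  anyᵇ : {A : Set} → (A → Bool) → List A → Bool
  anyᵇ P = foldr (λ x b → P x ∨ b) false

  sumℕ : List ℕ → ℕ
  sumℕ = foldr ℕ._+_ 0

  prodℕ : List ℕ → ℕ
  prodℕ = foldr ℕ._*_ 1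

  vecs : ℕ → List Pol
  vecs zero = [] ∷ []
  vecs (suc m) = concatMap (λ a → map (a ∷_) (vecs m)) elements

  polysDeg : ℕ → List Pol
  polysDeg n = concatMap (λ v → map (λ c → v ++ (c ∷ [])) (filterᵇ (λ c → not (isZ c)) elements)) (vecs n)

  monicDeg : ℕ → List Pol
  monicDeg n = map (λ v → v ++ (1# ∷ [])) (vecs n)

  polysUpTo : ℕ → List Pol
  polysUpTo d = [] ∷ concatMap polysDeg (upTo (suc d))

  monicUpTo : ℕ → List Pol
  monicUpTo d = concatMap monicDeg (upTo (suc d))

  tuples : {A : Set} → ℕ → List A → List (List A)
  tuples zero L = [] ∷ []
  tuples (suc k) L = concatMap (λ x → map (x ∷_) (tuples k L)) L

  nonconst : Pol → Bool
  nonconst p = 1 ≤ᵇ deg p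

  -- P irreducible: P is non-constant and is not a product a·b of two
  -- non-constant polynomials (the units of F_q[T] are the nonzero
  -- constants; factors of P necessarily have degree ≤ deg P)
  irreducible : Pol → Bool
  irreducible P =
    nonconst P ∧
    not (anyᵇ (λ a → anyᵇ (λ b → nonconst a ∧ nonconst b ∧ ((a ⊗ b) == P))
                         (polysUpTo (deg P)))
              (polysUpTo (deg P)))

  -- Q ∣ g  iff  g = Q·c for some c (necessarily deg c ≤ deg g)
  divides : Pol → Pol → Bool
  divides Q g = anyᵇ (λ c → (Q ⊗ c) == g) (polysUpTo (deg g))

  congruent : Pol → Pol → Pol → Bool
  congruent f A Q = divides Q (f ⊖ A)

  -- von Mangoldt, for monic f: deg P if f = P^j, P monic irreducible, j ≥ 1
  -- (P and j necessarily have deg P ≤ deg f, j ≤ deg f)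
  Λ : Pol → ℕ
  Λ f with filterᵇ (λ { (P , j) → irreducible P ∧ ((P ^P j) == f) })
                   (concatMap (λ P → map (λ j → (P , suc j)) (upTo (deg f))) (monicUpTo (deg f)))
  ... | [] = 0
  ... | (P , j) ∷ _ = deg P

  -- Λ_k for monic f: sum over ordered k-tuples of monic f_i with
  -- f_1⋯f_k = f (necessarily deg f_i ≤ deg f)
  Λmon : ℕ → Pol → ℕ
  Λmon k f = sumℕ (map (λ fs → prodℕ (map Λ fs))
                       (filterᵇ (λ fs → prodP fs == f) (tuples k (monicUpTo (deg f)))))

  Λk : ℕ → Pol → ℕ
  Λk k f = Λmon k (monicize f)

  -- N^U_{0,Λ_k}(A;h) for monic A: sum over monic f with |f − A| ≤ q^h and
  -- f(0) ≠ 0.  Any monic f with deg f > deg A has |f − A| = q^{deg f} > q^h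
  -- whenever h < deg A, so we enumerate monic f with deg f ≤ deg A.
  NU : ℕ → Pol → ℕ → ℕ
  NU k A h = sumℕ (map (Λk k)
    (filterᵇ (λ f → (∣ f ⊖ A ∣ ≤ᵇ q ℕ.^ h) ∧ not (isZ (at0 f))) (monicUpTo (deg A))))

  Ψ̃ : ℕ → ℕ → Pol → Pol → ℕ
  Ψ̃ k n Q A = sumℕ (map (Λk k) (filterᵇ (λ f → congruent f A Q) (polysDeg n)))

{-# OPTIONS --safe #-}
module Submission where

-- Reversal f ↦ f* = T^(deg f) f(1/T) sends a monic f of degree n with f(0) ≠ 0 whose coefficients
-- above T^h are those of A = T^(h+1) B (that is, |f - A| ≤ q^h) to a polynomial of degree n whose
-- coefficients below T^(n-h) are those of B* (that is, f* ≡ B* mod T^(n-h)), and back, because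
-- (f*)* = f when f(0) ≠ 0. Reversal is multiplicative, so ρ f, the monic associate of f*, is a
-- multiplicative involution on monic polynomials prime to T which preserves degrees and
-- irreducibility. It therefore permutes the ordered factorizations f = f₁⋯f_k and keeps every
-- Λ(fᵢ), so Λ_k(f*) = Λ_k(ρ f) = Λ_k(f) and the two sums agree term by term.

open import Defs
open import Level using (0ℓ)
open import Algebra.Bundles using (CommutativeRing)
import Algebra.Properties.AbelianGroup as AbelianGroupProperties
import Algebra.Properties.CommutativeSemigroup as CommutativeSemigroupProperties
import Algebra.Properties.Ring as RingProperties
open import Data.Bool using (Bool; true; false; T; not; _∧_)
open import Data.Bool.Properties using (T-∧; T-∨; T-not-≡)
open import Data.Empty using (⊥; ⊥-elim)
open import Data.List as List using (List; []; _∷_; _++_; _∷ʳ_; map; concatMap; length; replicate; reverse; upTo; initLast; _∷ʳ′_)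
import Data.List.Properties as Listₚ
open Listₚ using (≡-dec)
open import Data.List.Membership.Propositional using (_∈_; find; lose)
open import Data.List.Membership.Propositional.Properties
  using (∈-map⁺; ∈-map⁻; ∈-concatMap⁺; ∈-concatMap⁻; ∈-filter⁺; ∈-filter⁻; ∈-upTo⁺; ∈-upTo⁻; ∈-length)
open import Data.List.Membership.Propositional.Properties.WithK using (unique∧set⇒bag)
open import Data.List.Relation.Binary.BagAndSetEquality using (∼bag⇒↭)
import Data.List.Relation.Binary.Permutation.Propositional.Properties as ↭
open import Data.List.Relation.Binary.Subset.Propositional using (_⊆_)
open import Data.List.Relation.Unary.All as All using (All; []; _∷_)
open import Data.List.Relation.Unary.AllPairs using ([]; _∷_)
open import Data.List.Relation.Unary.Any using (here; there)
open import Data.List.Relation.Unary.Unique.Propositional using (Unique)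
import Data.List.Relation.Unary.Unique.Propositional.Properties as Uniqueₚ
open import Data.Nat as ℕ using (ℕ; zero; suc; _∸_; _≤_; _<_; _≤ᵇ_; z≤n; s≤s)
open import Data.Nat.ListAction.Properties using (sum-↭)
import Data.Nat.Properties as ℕₚ
open import Data.Product using (_×_; _,_; proj₁; proj₂; Σ; ∃-syntax)
open import Data.Sum using (_⊎_; inj₁; inj₂)
open import Data.Unit using (⊤; tt)
open import Function using (_∘_)
open import Function.Bundles using (Equivalence; mk⇔)
open import Relation.Binary.Bundles using (Setoid)
open import Relation.Binary.Definitions using (tri<; tri≈; tri>)
open import Relation.Binary.PropositionalEquality
import Relation.Binary.Reasoning.Setoid as SetoidReasoning
open import Relation.Nullary using (¬_; yes; no)
open import Relation.Nullary.Decidable using (T?)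

-- filterᵇ, anyᵇ, sumℕ and tuples live inside Poly F, whence the field parameter.
module Lists (F : FiniteField) where
  open Poly F using (filterᵇ; anyᵇ; sumℕ; tuples)

  module _ {A : Set} where
    filterᵇ≡filter : ∀ (P : A → Bool) xs → filterᵇ P xs ≡ List.filter (T? ∘ P) xs
    filterᵇ≡filter P []       = refl
    filterᵇ≡filter P (x ∷ xs) with P x
    ... | true  = cong (x ∷_) (filterᵇ≡filter P xs)
    ... | false = filterᵇ≡filter P xs

    ∈-filterᵇ⁻ : ∀ (P : A → Bool) {xs x} → x ∈ filterᵇ P xs → x ∈ xs × T (P x)
    ∈-filterᵇ⁻ P {xs} x∈ = ∈-filter⁻ (T? ∘ P) (subst (_ ∈_) (filterᵇ≡filter P xs) x∈)

    ∈-filterᵇ⁺ : ∀ (P : A → Bool) {xs x} → x ∈ xs → T (P x) → x ∈ filterᵇ P xs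
    ∈-filterᵇ⁺ P {xs} x∈ Px = subst (_ ∈_) (sym (filterᵇ≡filter P xs)) (∈-filter⁺ (T? ∘ P) x∈ Px)

    filterᵇ-unique : ∀ (P : A → Bool) {xs} → Unique xs → Unique (filterᵇ P xs)
    filterᵇ-unique P {xs} u = subst Unique (sym (filterᵇ≡filter P xs)) (Uniqueₚ.filter⁺ (T? ∘ P) u)

    anyᵇ-sound : ∀ (P : A → Bool) xs → T (anyᵇ P xs) → ∃[ x ] x ∈ xs × T (P x)
    anyᵇ-sound P (x ∷ xs) t with P x in Px≡
    ... | true  = x , here refl , subst T (sym Px≡) tt
    ... | false with anyᵇ-sound P xs t
    ...   | y , y∈ , Py = y , there y∈ , Py

    anyᵇ-complete : ∀ (P : A → Bool) {xs x} → x ∈ xs → T (P x) → T (anyᵇ P xs)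
    anyᵇ-complete P {y ∷ xs} (here refl) Px = Equivalence.from T-∨ (inj₁ Px)
    anyᵇ-complete P {y ∷ xs} (there x∈) Px = Equivalence.from T-∨ (inj₂ (anyᵇ-complete P x∈ Px))

    sumℕ-bijection : ∀ (w₁ w₂ : A → ℕ) (φ ψ : A → A) {xs ys} → Unique xs → Unique ys →
      (∀ {x} → x ∈ xs → φ x ∈ ys) → (∀ {y} → y ∈ ys → ψ y ∈ xs) →
      (∀ {x} → x ∈ xs → ψ (φ x) ≡ x) → (∀ {y} → y ∈ ys → φ (ψ y) ≡ y) →
      (∀ {x} → x ∈ xs → w₂ (φ x) ≡ w₁ x) →
      sumℕ (map w₁ xs) ≡ sumℕ (map w₂ ys)
    sumℕ-bijection w₁ w₂ φ ψ {xs} {ys} xs! ys! φ∈ ψ∈ ψφ φψ w≡ = begin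
      sumℕ (map w₁ xs)         ≡⟨ cong sumℕ (Listₚ.map-cong-local (All.tabulate λ x∈ → sym (w≡ x∈))) ⟩
      sumℕ (map (w₂ ∘ φ) xs)   ≡⟨ cong sumℕ (Listₚ.map-∘ xs) ⟩
      sumℕ (map w₂ (map φ xs)) ≡⟨ sum-↭ (↭.map⁺ w₂ (∼bag⇒↭ (unique∧set⇒bag φxs! ys! (mk⇔ to from)))) ⟩
      sumℕ (map w₂ ys)         ∎
      where
      open ≡-Reasoning
      φxs! : Unique (map φ xs)
      φxs! = Uniqueₚ.map⁻ {f = ψ} (subst Unique
        (sym (trans (sym (Listₚ.map-∘ xs)) (Listₚ.map-id-local (All.tabulate ψφ)))) xs!)
      to : ∀ {y} → y ∈ map φ xs → y ∈ ys
      to y∈ with ∈-map⁻ φ y∈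
      ... | x , x∈ , refl = φ∈ x∈
      from : ∀ {y} → y ∈ ys → y ∈ map φ xs
      from y∈ = subst (_∈ map φ xs) (φψ y∈) (∈-map⁺ φ (ψ∈ y∈))

  module _ {A B : Set} (f : A → List B) where
    ∈-concatMap⁻′ : ∀ xs {y} → y ∈ concatMap f xs → ∃[ x ] x ∈ xs × y ∈ f x
    ∈-concatMap⁻′ xs y∈ = find (∈-concatMap⁻ f y∈)

    ∈-concatMap⁺′ : ∀ xs {x y} → x ∈ xs → y ∈ f x → y ∈ concatMap f xs
    ∈-concatMap⁺′ xs x∈ y∈ = ∈-concatMap⁺ f (lose x∈ y∈)

    concatMap-unique : ∀ {xs} → Unique xs → (∀ x → Unique (f x)) →
      (tag : B → A) → (∀ x {y} → y ∈ f x → tag y ≡ x) → Unique (concatMap f xs)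
    concatMap-unique {[]}     _          _   tag tag≡ = []
    concatMap-unique {x ∷ xs} (x∉ ∷ xs!) fx! tag tag≡ =
      Uniqueₚ.++⁺ (fx! x) (concatMap-unique xs! fx! tag tag≡) disjoint
      where
      disjoint : ∀ {y} → ¬ (y ∈ f x × y ∈ concatMap f xs)
      disjoint (y∈fx , y∈rest) with ∈-concatMap⁻′ xs y∈rest
      ... | x′ , x′∈ , y∈fx′ = All.lookup x∉ x′∈ (trans (sym (tag≡ x y∈fx)) (tag≡ x′ y∈fx′))

  module _ {A : Set} where
    ∈-tuples⁻ : ∀ k (L : List A) {fs} → fs ∈ tuples k L → length fs ≡ k × fs ⊆ L
    ∈-tuples⁻ zero    L (here refl) = refl , λ ()
    ∈-tuples⁻ (suc k) L fs∈ with ∈-concatMap⁻′ (λ x → map (x ∷_) (tuples k L)) L fs∈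
    ... | x , x∈ , fs∈x with ∈-map⁻ (x ∷_) fs∈x
    ...   | gs , gs∈ , refl with ∈-tuples⁻ k L gs∈
    ...     | len≡ , gs⊆ = cong suc len≡ , λ { (here refl) → x∈ ; (there y∈) → gs⊆ y∈ }

    ∈-tuples⁺ : ∀ k (L : List A) {fs} → length fs ≡ k → fs ⊆ L → fs ∈ tuples k L
    ∈-tuples⁺ zero    L {[]}     refl _   = here refl
    ∈-tuples⁺ (suc k) L {x ∷ fs} refl fs⊆ = ∈-concatMap⁺′ (λ x → map (x ∷_) (tuples k L)) L (fs⊆ (here refl))
      (∈-map⁺ (x ∷_) (∈-tuples⁺ k L refl (fs⊆ ∘ there)))

    tuples-unique : ∀ k {L : List A} → Unique L → Unique (tuples k L)
    tuples-unique zero    L! = All.[] ∷ []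
    tuples-unique (suc k) {[]}     L! = []
    tuples-unique (suc k) {x₀ ∷ L} L! = concatMap-unique (λ x → map (x ∷_) (tuples k (x₀ ∷ L))) L!
      (λ x → Uniqueₚ.map⁺ Listₚ.∷-injectiveʳ (tuples-unique k L!)) headOr tag≡
      where
      headOr : List A → A
      headOr []      = x₀
      headOr (x ∷ _) = x
      tag≡ : ∀ x {fs} → fs ∈ map (x ∷_) (tuples k (x₀ ∷ L)) → headOr fs ≡ x
      tag≡ x fs∈ with ∈-map⁻ (x ∷_) fs∈
      ... | _ , _ , refl = refl

module FieldFacts (F : FiniteField) where
  open FiniteField F
    renaming (_+_ to infixl 6 _+_; _*_ to infixl 7 _*_; -_ to infix 8 -_; _⁻¹ to infix 9 _⁻¹)

  commutativeRing : CommutativeRing 0ℓ 0ℓ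
  commutativeRing = record { isCommutativeRing = isCommutativeRing }

  open CommutativeRing commutativeRing public
    using (+-assoc; +-comm; +-identityˡ; +-identityʳ; -‿inverseˡ; -‿inverseʳ;
           *-assoc; *-comm; *-identityˡ; *-identityʳ; distribˡ; distribʳ; zeroˡ; zeroʳ)
  open RingProperties (CommutativeRing.ring commutativeRing) public using (-1*x≈-x)
  open AbelianGroupProperties (CommutativeRing.+-abelianGroup commutativeRing) public
    using (x∙y⁻¹≈ε⇒x≈y; x≈y⇒x∙y⁻¹≈ε) renaming (ε⁻¹≈ε to -0≡0)
  open CommutativeSemigroupProperties (CommutativeRing.+-commutativeSemigroup commutativeRing) public
    using (interchange) renaming (x∙yz≈y∙xz to +-swap)
  open CommutativeSemigroupProperties (CommutativeRing.*-commutativeSemigroup commutativeRing) public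
    using () renaming (x∙yz≈y∙xz to *-swap; interchange to *-interchange)

  1≢0 : 1# ≢ 0#
  1≢0 1≡0 = 0≢1 (sym 1≡0)

  inverseˡ : ∀ x → x ≢ 0# → x ⁻¹ * x ≡ 1#
  inverseˡ x x≢0 = trans (*-comm _ x) (inverseʳ x x≢0)

  x+-1*x≡0 : ∀ x → x + (- 1# * x) ≡ 0#
  x+-1*x≡0 x = trans (cong (x +_) (-1*x≈-x x)) (-‿inverseʳ x)

  [x+-1*y]+y≡x : ∀ x y → (x + (- 1# * y)) + y ≡ x
  [x+-1*y]+y≡x x y = begin
    (x + (- 1# * y)) + y ≡⟨ +-assoc x _ y ⟩
    x + (- 1# * y + y)   ≡⟨ cong (λ z → x + (z + y)) (-1*x≈-x y) ⟩
    x + (- y + y)        ≡⟨ cong (x +_) (-‿inverseˡ y) ⟩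
    x + 0#               ≡⟨ +-identityʳ x ⟩
    x                    ∎
    where open ≡-Reasoning

  x≢0∧y≢0⇒x*y≢0 : ∀ {x y} → x ≢ 0# → y ≢ 0# → x * y ≢ 0#
  x≢0∧y≢0⇒x*y≢0 {x} {y} x≢0 y≢0 xy≡0 = x≢0 (begin
    x                ≡⟨ sym (*-identityʳ x) ⟩
    x * 1#           ≡⟨ cong (x *_) (sym (inverseʳ y y≢0)) ⟩
    x * (y * y ⁻¹)   ≡⟨ sym (*-assoc x y (y ⁻¹)) ⟩
    (x * y) * y ⁻¹   ≡⟨ cong (_* y ⁻¹) xy≡0 ⟩
    0# * y ⁻¹        ≡⟨ zeroˡ _ ⟩
    0#               ∎)
    where open ≡-Reasoning

  x*y≡1⇒y≡x⁻¹ : ∀ {x y} → x * y ≡ 1# → y ≡ x ⁻¹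
  x*y≡1⇒y≡x⁻¹ {x} {y} xy≡1 = begin
    y                ≡⟨ sym (*-identityʳ y) ⟩
    y * 1#           ≡⟨ cong (y *_) (sym (inverseʳ x x≢0)) ⟩
    y * (x * x ⁻¹)   ≡⟨ sym (*-assoc y x (x ⁻¹)) ⟩
    (y * x) * x ⁻¹   ≡⟨ cong (_* x ⁻¹) (trans (*-comm y x) xy≡1) ⟩
    1# * x ⁻¹        ≡⟨ *-identityˡ _ ⟩
    x ⁻¹             ∎
    where
    open ≡-Reasoning
    x≢0 : x ≢ 0#
    x≢0 x≡0 = 0≢1 (trans (sym (zeroˡ y)) (trans (cong (_* y) (sym x≡0)) xy≡1))

  ⁻¹-≢0 : ∀ {x} → x ≢ 0# → x ⁻¹ ≢ 0#
  ⁻¹-≢0 {x} x≢0 x⁻¹≡0 = 0≢1 (trans (sym (zeroʳ x)) (trans (cong (x *_) (sym x⁻¹≡0)) (inverseʳ x x≢0)))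

  1⁻¹≡1 : 1# ⁻¹ ≡ 1#
  1⁻¹≡1 = sym (x*y≡1⇒y≡x⁻¹ (*-identityʳ 1#))

  ⁻¹-distrib-* : ∀ {x y} → x ≢ 0# → y ≢ 0# → (x * y) ⁻¹ ≡ x ⁻¹ * y ⁻¹
  ⁻¹-distrib-* {x} {y} x≢0 y≢0 = sym (x*y≡1⇒y≡x⁻¹ (begin
    (x * y) * (x ⁻¹ * y ⁻¹)   ≡⟨ *-interchange x y (x ⁻¹) (y ⁻¹) ⟩
    (x * x ⁻¹) * (y * y ⁻¹)   ≡⟨ cong₂ _*_ (inverseʳ x x≢0) (inverseʳ y y≢0) ⟩
    1# * 1#                   ≡⟨ *-identityˡ 1# ⟩
    1#                        ∎))
    where open ≡-Reasoning

module Coefficients (F : FiniteField) where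
  open FiniteField F
    renaming (_+_ to infixl 6 _+_; _*_ to infixl 7 _*_; -_ to infix 8 -_; _⁻¹ to infix 9 _⁻¹)
  open Poly F renaming (_⊖_ to infixl 6 _⊖_; _⊗_ to infixl 7 _⊗_; _^P_ to infixr 8 _^P_;
                        _* to infix 10 _*; _==_ to infix 4 _==_)

  coeff : Pol → ℕ → Carrier
  coeff []      i       = 0#
  coeff (a ∷ p) zero    = a
  coeff (a ∷ p) (suc i) = coeff p i

  -- Equality of polynomials: addL, scaleL and mulL leave trailing zeros, which ≈ ignores.
  infix 4 _≈_
  record _≈_ (p r : Pol) : Set where
    constructor mk≈
    field at : ∀ i → coeff p i ≡ coeff r i
  open _≈_ public

  ≈-refl : ∀ {p} → p ≈ p
  ≈-refl = mk≈ λ _ → refl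

  ≈-sym : ∀ {p r} → p ≈ r → r ≈ p
  ≈-sym p≈r = mk≈ λ i → sym (at p≈r i)

  ≈-trans : ∀ {p r s} → p ≈ r → r ≈ s → p ≈ s
  ≈-trans p≈r r≈s = mk≈ λ i → trans (at p≈r i) (at r≈s i)

  ≈-setoid : Setoid 0ℓ 0ℓ
  ≈-setoid = record
    { Carrier = Pol ; _≈_ = _≈_
    ; isEquivalence = record { refl = ≈-refl ; sym = ≈-sym ; trans = ≈-trans } }

  ≡⇒≈ : ∀ {p r} → p ≡ r → p ≈ r
  ≡⇒≈ refl = ≈-refl

  coeff-strip : ∀ p i → coeff (strip p) i ≡ coeff p i
  coeff-strip []      i = refl
  coeff-strip (a ∷ p) i with strip p | coeff-strip p
  ... | b ∷ s | ih = cons i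
    where
    cons : ∀ i → coeff (a ∷ b ∷ s) i ≡ coeff (a ∷ p) i
    cons zero    = refl
    cons (suc i) = ih i
  ... | [] | ih with a ≟ 0#
  ...   | yes a≡0 = single i
    where
    single : ∀ i → 0# ≡ coeff (a ∷ p) i
    single zero    = sym a≡0
    single (suc i) = ih i
  ...   | no _ = single i
    where
    single : ∀ i → coeff (a ∷ []) i ≡ coeff (a ∷ p) i
    single zero    = refl
    single (suc i) = ih i

  strip-≈ : ∀ p → strip p ≈ p
  strip-≈ p = mk≈ (coeff-strip p)

  strip-cong : ∀ {p r} → p ≈ r → strip p ≡ strip r
  strip-cong {[]}    {[]}    e = refl
  strip-cong {[]}    {b ∷ r} e with strip r | strip-cong {[]} {r} (mk≈ λ i → at e (suc i))
  ... | _ | refl with b ≟ 0#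
  ...   | yes _   = refl
  ...   | no b≢0 = ⊥-elim (b≢0 (sym (at e 0)))
  strip-cong {a ∷ p} {[]}    e with strip p | strip-cong {p} {[]} (mk≈ λ i → at e (suc i))
  ... | _ | refl with a ≟ 0#
  ...   | yes _   = refl
  ...   | no a≢0 = ⊥-elim (a≢0 (at e 0))
  strip-cong {a ∷ p} {b ∷ r} e with at e 0
  ... | refl with strip p | strip r | strip-cong {p} {r} (mk≈ λ i → at e (suc i))
  ...   | _ | _ | refl = refl

  Normal : Pol → Set
  Normal p = strip p ≡ p

  strip-normal : ∀ p → Normal (strip p)
  strip-normal p = strip-cong (strip-≈ p)

  ≈⇒≡ : ∀ {p r} → Normal p → Normal r → p ≈ r → p ≡ r
  ≈⇒≡ {p} {r} np nr p≈r = trans (sym np) (trans (strip-cong p≈r) nr)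

  ==-complete : ∀ {p r} → p ≈ r → T (p == r)
  ==-complete {p} {r} p≈r with ≡-dec _≟_ (strip p) (strip r)
  ... | yes _ = tt
  ... | no ≢ = ≢ (strip-cong p≈r)

  ==-sound : ∀ p r → T (p == r) → p ≈ r
  ==-sound p r t with ≡-dec _≟_ (strip p) (strip r)
  ... | yes eq = ≈-trans (≈-sym (strip-≈ p)) (≈-trans (≡⇒≈ eq) (strip-≈ r))

  record Nonzero (p : Pol) : Set where
    constructor nonzero
    field strip≢[] : strip p ≢ []

  ≈[]⇒¬Nonzero : ∀ {p} → p ≈ [] → ¬ Nonzero p
  ≈[]⇒¬Nonzero p≈[] (nonzero ne) = ne (strip-cong p≈[])

  Nonzero-cong : ∀ {p r} → p ≈ r → Nonzero p → Nonzero r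
  Nonzero-cong p≈r (nonzero ne) = nonzero λ eq → ne (trans (strip-cong p≈r) eq)

  nonzero? : ∀ p → Nonzero p ⊎ p ≈ []
  nonzero? p with ≡-dec _≟_ (strip p) []
  ... | yes eq = inj₂ (≈-trans (≈-sym (strip-≈ p)) (≡⇒≈ eq))
  ... | no  ne = inj₁ (nonzero ne)

  ¬≈[]⇒Nonzero : ∀ {p} → ¬ p ≈ [] → Nonzero p
  ¬≈[]⇒Nonzero {p} p≉[] with nonzero? p
  ... | inj₁ p≢0  = p≢0
  ... | inj₂ p≈[] = ⊥-elim (p≉[] p≈[])

  nonzero-witness : ∀ {p d} → coeff p d ≢ 0# → Nonzero p
  nonzero-witness {p} {d} c≢0 = nonzero λ eq →
    c≢0 (trans (sym (coeff-strip p d)) (cong (λ s → coeff s d) eq))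

  DegAtMost : Pol → ℕ → Set
  DegAtMost p d = ∀ i → d < i → coeff p i ≡ 0#

  DegBelow : Pol → ℕ → Set
  DegBelow p n = ∀ i → n ≤ i → coeff p i ≡ 0#

  coeff-length : ∀ p → DegBelow p (length p)
  coeff-length []      i       _        = refl
  coeff-length (a ∷ p) (suc i) (s≤s le) = coeff-length p i le

  coeff-last : ∀ a p → coeff (a ∷ p) (length p) ≡ lastC (a ∷ p)
  coeff-last a []      = refl
  coeff-last a (b ∷ p) = coeff-last b p

  coeff-++-< : ∀ xs {ys i} → i < length xs → coeff (xs ++ ys) i ≡ coeff xs i
  coeff-++-< (x ∷ xs) {i = zero}  _        = refl
  coeff-++-< (x ∷ xs) {i = suc i} (s≤s lt) = coeff-++-< xs lt

  coeff-++-length : ∀ xs ys → coeff (xs ++ ys) (length xs) ≡ coeff ys 0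
  coeff-++-length []       ys = refl
  coeff-++-length (x ∷ xs) ys = coeff-++-length xs ys

  deg-cong : ∀ {p r} → p ≈ r → deg p ≡ deg r
  deg-cong p≈r = cong (λ s → length s ∸ 1) (strip-cong p≈r)

  lead-cong : ∀ {p r} → p ≈ r → lead p ≡ lead r
  lead-cong p≈r = cong lastC (strip-cong p≈r)

  coeff-above-deg : ∀ p → DegAtMost p (deg p)
  coeff-above-deg p i lt with strip p | coeff-strip p
  ... | []    | cs = sym (cs i)
  ... | a ∷ s | cs = trans (sym (cs i)) (coeff-length (a ∷ s) i lt)

  coeff-deg : ∀ p → coeff p (deg p) ≡ lead p
  coeff-deg p with strip p | coeff-strip p
  ... | []    | cs = sym (cs 0)
  ... | a ∷ s | cs = trans (sym (cs (length s))) (coeff-last a s)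

  lead≢0 : ∀ {p} → Nonzero p → lead p ≢ 0#
  lead≢0 {p} (nonzero ne) with strip p in eq | last≢0 p
    where
    LastNonzero : Pol → Set
    LastNonzero []      = ⊤
    LastNonzero (a ∷ s) = lastC (a ∷ s) ≢ 0#
    last≢0 : ∀ p → LastNonzero (strip p)
    last≢0 []      = tt
    last≢0 (a ∷ p) with strip p | last≢0 p
    ... | b ∷ s | ne = ne
    ... | []    | _ with a ≟ 0#
    ...   | yes _   = tt
    ...   | no a≢0 = a≢0
  ... | []    | _  = ⊥-elim (ne eq)
  ... | _ ∷ _ | ne = ne

  deg-unique : ∀ p {d} → DegAtMost p d → coeff p d ≢ 0# → deg p ≡ d
  deg-unique p {d} p≤d c≢0 with ℕₚ.<-cmp (deg p) d
  ... | tri< lt _ _ = ⊥-elim (c≢0 (coeff-above-deg p d lt))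
  ... | tri≈ _ eq _ = eq
  ... | tri> _ _ gt = ⊥-elim (lead≢0 (nonzero-witness {p} c≢0) (trans (sym (coeff-deg p)) (p≤d (deg p) gt)))

  lead-unique : ∀ p {d} → DegAtMost p d → coeff p d ≢ 0# → lead p ≡ coeff p d
  lead-unique p p≤d c≢0 = trans (sym (coeff-deg p)) (cong (coeff p) (deg-unique p p≤d c≢0))

  deg≤ : ∀ p {d} → DegAtMost p d → deg p ≤ d
  deg≤ p {d} p≤d with nonzero? p | ℕₚ.≤-<-connex (deg p) d
  ... | _         | inj₁ le = le
  ... | inj₁ nz   | inj₂ gt = ⊥-elim (lead≢0 nz (trans (sym (coeff-deg p)) (p≤d (deg p) gt)))
  ... | inj₂ p≈[] | inj₂ _  = subst (_≤ d) (sym (deg-cong p≈[])) z≤n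

  deg< : ∀ p {n} → DegBelow p n → Nonzero p → deg p < n
  deg< p {n} p<n nz with ℕₚ.<-≤-connex (deg p) n
  ... | inj₁ lt = lt
  ... | inj₂ ge = ⊥-elim (lead≢0 nz (trans (sym (coeff-deg p)) (p<n (deg p) ge)))

  lastC-∷ʳ : ∀ v c → lastC (v ∷ʳ c) ≡ c
  lastC-∷ʳ []          c = refl
  lastC-∷ʳ (a ∷ [])     c = refl
  lastC-∷ʳ (a ∷ b ∷ v) c = lastC-∷ʳ (b ∷ v) c

  strip-∷ʳ : ∀ v {c} → c ≢ 0# → strip (v ∷ʳ c) ≡ v ∷ʳ c
  strip-∷ʳ []      {c} c≢0 with c ≟ 0#
  ... | yes c≡0 = ⊥-elim (c≢0 c≡0)
  ... | no  _   = refl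
  strip-∷ʳ (a ∷ v) {c} c≢0 with v ∷ʳ c | strip-∷ʳ v c≢0 | ∷ʳ-nonempty v
    where
    ∷ʳ-nonempty : ∀ v → ∃[ b ] ∃[ s ] v ∷ʳ c ≡ b ∷ s
    ∷ʳ-nonempty []      = c , [] , refl
    ∷ʳ-nonempty (b ∷ v) = b , v ∷ʳ c , refl
  ... | _ | eq | b , s , refl rewrite eq = refl

  length-∷ʳ∸1 : ∀ v (c : Carrier) → length (v ∷ʳ c) ∸ 1 ≡ length v
  length-∷ʳ∸1 v c = trans (cong (_∸ 1) (Listₚ.length-++ v)) (ℕₚ.m+n∸n≡m (length v) 1)

  module _ (v : Pol) {c : Carrier} (c≢0 : c ≢ 0#) where
    ∷ʳ-normal : Normal (v ∷ʳ c)
    ∷ʳ-normal = strip-∷ʳ v c≢0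

    ∷ʳ-nonzero : Nonzero (v ∷ʳ c)
    ∷ʳ-nonzero = nonzero λ eq → ∷ʳ≢[] v (trans (sym ∷ʳ-normal) eq)
      where
      ∷ʳ≢[] : ∀ v → v ∷ʳ c ≢ []
      ∷ʳ≢[] []      ()
      ∷ʳ≢[] (_ ∷ _) ()

    deg-∷ʳ : deg (v ∷ʳ c) ≡ length v
    deg-∷ʳ = trans (cong (λ s → length s ∸ 1) ∷ʳ-normal) (length-∷ʳ∸1 v c)

    lead-∷ʳ : lead (v ∷ʳ c) ≡ c
    lead-∷ʳ = trans (cong lastC ∷ʳ-normal) (lastC-∷ʳ v c)

  normal-∷ʳ : ∀ {f} → Normal f → Nonzero f → ∃[ v ] f ≡ v ∷ʳ lead f × length v ≡ deg f
  normal-∷ʳ {f} f-normal (nonzero f≢[]) with initLast f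
  ... | []      = ⊥-elim (f≢[] f-normal)
  ... | v ∷ʳ′ x = v , cong (v ∷ʳ_) (sym lead≡x) , sym (trans (cong (λ s → length s ∸ 1) f-normal) (length-∷ʳ∸1 v x))
    where
    lead≡x : lead (v ∷ʳ x) ≡ x
    lead≡x = trans (cong lastC f-normal) (lastC-∷ʳ v x)

module Arithmetic (F : FiniteField) where
  open FiniteField F
    renaming (_+_ to infixl 6 _+_; _*_ to infixl 7 _*_; -_ to infix 8 -_; _⁻¹ to infix 9 _⁻¹)
  open Poly F renaming (_⊖_ to infixl 6 _⊖_; _⊗_ to infixl 7 _⊗_; _^P_ to infixr 8 _^P_;
                        _* to infix 10 _*; _==_ to infix 4 _==_)
  open FieldFacts F
  open Coefficients F

  coeff-addL : ∀ p r i → coeff (addL p r) i ≡ coeff p i + coeff r i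
  coeff-addL []      r       i       = sym (+-identityˡ _)
  coeff-addL (a ∷ p) []      i       = sym (+-identityʳ _)
  coeff-addL (a ∷ p) (b ∷ r) zero    = refl
  coeff-addL (a ∷ p) (b ∷ r) (suc i) = coeff-addL p r i

  coeff-scaleL : ∀ c p i → coeff (scaleL c p) i ≡ c * coeff p i
  coeff-scaleL c []      i       = sym (zeroʳ c)
  coeff-scaleL c (a ∷ p) zero    = refl
  coeff-scaleL c (a ∷ p) (suc i) = coeff-scaleL c p i

  coeff-neg : ∀ p i → coeff (map -_ p) i ≡ - coeff p i
  coeff-neg []      i       = sym -0≡0
  coeff-neg (a ∷ p) zero    = refl
  coeff-neg (a ∷ p) (suc i) = coeff-neg p i

  coeff-⊖ : ∀ p r i → coeff (p ⊖ r) i ≡ coeff p i + - coeff r i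
  coeff-⊖ p r i = trans (coeff-strip (addL p (map -_ r)) i)
    (trans (coeff-addL p (map -_ r) i) (cong (coeff p i +_) (coeff-neg r i)))

  coeff-⊖≡0 : ∀ f g i → coeff (f ⊖ g) i ≡ 0# → coeff f i ≡ coeff g i
  coeff-⊖≡0 f g i eq = x∙y⁻¹≈ε⇒x≈y _ _ (trans (sym (coeff-⊖ f g i)) eq)

  coeff-≡⇒⊖≡0 : ∀ f g i → coeff f i ≡ coeff g i → coeff (f ⊖ g) i ≡ 0#
  coeff-≡⇒⊖≡0 f g i eq = trans (coeff-⊖ f g i) (x≈y⇒x∙y⁻¹≈ε eq)

  -- conv f g n = Σ_{i ≤ n} f i * g (n - i), the n-th coefficient of a product.
  conv : (ℕ → Carrier) → (ℕ → Carrier) → ℕ → Carrier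
  conv f g zero    = f 0 * g 0
  conv f g (suc n) = f 0 * g (suc n) + conv (λ i → f (suc i)) g n

  conv-cong : ∀ {f f′ g g′} → (∀ i → f i ≡ f′ i) → (∀ i → g i ≡ g′ i) →
              ∀ n → conv f g n ≡ conv f′ g′ n
  conv-cong f≗ g≗ zero    = cong₂ _*_ (f≗ 0) (g≗ 0)
  conv-cong f≗ g≗ (suc n) = cong₂ _+_ (cong₂ _*_ (f≗ 0) (g≗ (suc n))) (conv-cong (λ i → f≗ (suc i)) g≗ n)

  conv-zeroˡ : ∀ {f} g → (∀ i → f i ≡ 0#) → ∀ n → conv f g n ≡ 0#
  conv-zeroˡ g f≗0 zero    = trans (cong (λ x → x * g 0) (f≗0 0)) (zeroˡ _)
  conv-zeroˡ g f≗0 (suc n) = trans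
    (cong₂ _+_ (trans (cong (λ x → x * g (suc n)) (f≗0 0)) (zeroˡ _)) (conv-zeroˡ g (λ i → f≗0 (suc i)) n))
    (+-identityˡ 0#)

  conv-zeroʳ : ∀ f {g} → (∀ i → g i ≡ 0#) → ∀ n → conv f g n ≡ 0#
  conv-zeroʳ f g≗0 zero    = trans (cong (f 0 *_) (g≗0 0)) (zeroʳ _)
  conv-zeroʳ f g≗0 (suc n) = trans
    (cong₂ _+_ (trans (cong (f 0 *_) (g≗0 (suc n))) (zeroʳ _)) (conv-zeroʳ (λ i → f (suc i)) g≗0 n))
    (+-identityˡ 0#)

  conv-distribʳ : ∀ f f′ g n → conv (λ i → f i + f′ i) g n ≡ conv f g n + conv f′ g n
  conv-distribʳ f f′ g zero    = distribʳ (g 0) (f 0) (f′ 0)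
  conv-distribʳ f f′ g (suc n) = trans
    (cong₂ _+_ (distribʳ (g (suc n)) (f 0) (f′ 0)) (conv-distribʳ (λ i → f (suc i)) (λ i → f′ (suc i)) g n))
    (interchange _ _ _ _)

  conv-scaleˡ : ∀ c f g n → conv (λ i → c * f i) g n ≡ c * conv f g n
  conv-scaleˡ c f g zero    = *-assoc c (f 0) (g 0)
  conv-scaleˡ c f g (suc n) = trans
    (cong₂ _+_ (*-assoc c (f 0) (g (suc n))) (conv-scaleˡ c (λ i → f (suc i)) g n))
    (sym (distribˡ c _ _))

  conv-scaleʳ : ∀ c f g n → conv f (λ i → c * g i) n ≡ c * conv f g n
  conv-scaleʳ c f g zero    = *-swap (f 0) c (g 0)
  conv-scaleʳ c f g (suc n) = trans
    (cong₂ _+_ (*-swap (f 0) c (g (suc n))) (conv-scaleʳ c (λ i → f (suc i)) g n))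
    (sym (distribˡ c _ _))

  coeff-mulL : ∀ p r n → coeff (mulL p r) n ≡ conv (coeff p) (coeff r) n
  coeff-mulL []      r n       = sym (conv-zeroˡ (coeff r) (λ _ → refl) n)
  coeff-mulL (a ∷ p) r zero    = trans (coeff-addL (scaleL a r) _ 0) (trans (+-identityʳ _) (coeff-scaleL a r 0))
  coeff-mulL (a ∷ p) r (suc n) = trans (coeff-addL (scaleL a r) _ (suc n))
    (cong₂ _+_ (coeff-scaleL a r (suc n)) (coeff-mulL p r n))

  coeff-⊗ : ∀ p r n → coeff (p ⊗ r) n ≡ conv (coeff p) (coeff r) n
  coeff-⊗ p r n = trans (coeff-strip (mulL p r) n) (coeff-mulL p r n)

  ⊗-≈ : ∀ p r → p ⊗ r ≈ mulL p r
  ⊗-≈ p r = strip-≈ (mulL p r)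

  coeff₀-⊗ : ∀ p r → coeff (p ⊗ r) 0 ≡ coeff p 0 * coeff r 0
  coeff₀-⊗ p r = coeff-⊗ p r 0

  ∷-≈ : ∀ {a b p r} → a ≡ b → p ≈ r → a ∷ p ≈ b ∷ r
  ∷-≈ refl p≈r = mk≈ λ { zero → refl ; (suc i) → at p≈r i }

  addL-cong : ∀ {p p′ r r′} → p ≈ p′ → r ≈ r′ → addL p r ≈ addL p′ r′
  addL-cong {p} {p′} {r} {r′} p≈ r≈ = mk≈ λ i →
    trans (coeff-addL p r i) (trans (cong₂ _+_ (at p≈ i) (at r≈ i)) (sym (coeff-addL p′ r′ i)))

  scaleL-cong : ∀ {c p p′} → p ≈ p′ → scaleL c p ≈ scaleL c p′
  scaleL-cong {c} {p} {p′} p≈ = mk≈ λ i →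
    trans (coeff-scaleL c p i) (trans (cong (c *_) (at p≈ i)) (sym (coeff-scaleL c p′ i)))

  mulL-cong : ∀ {p p′ r r′} → p ≈ p′ → r ≈ r′ → mulL p r ≈ mulL p′ r′
  mulL-cong {p} {p′} {r} {r′} p≈ r≈ = mk≈ λ i →
    trans (coeff-mulL p r i) (trans (conv-cong (at p≈) (at r≈) i) (sym (coeff-mulL p′ r′ i)))

  ⊗-cong : ∀ {p p′ r r′} → p ≈ p′ → r ≈ r′ → p ⊗ r ≈ p′ ⊗ r′
  ⊗-cong {p} {p′} {r} {r′} p≈ r≈ = ≈-trans (⊗-≈ p r) (≈-trans (mulL-cong p≈ r≈) (≈-sym (⊗-≈ p′ r′)))

  addL-comm : ∀ p r → addL p r ≈ addL r p
  addL-comm p r = mk≈ λ i → trans (coeff-addL p r i) (trans (+-comm _ _) (sym (coeff-addL r p i)))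

  addL-assoc : ∀ p r s → addL (addL p r) s ≈ addL p (addL r s)
  addL-assoc p r s = mk≈ λ i → begin
    coeff (addL (addL p r) s) i       ≡⟨ coeff-addL (addL p r) s i ⟩
    coeff (addL p r) i + coeff s i    ≡⟨ cong (_+ coeff s i) (coeff-addL p r i) ⟩
    coeff p i + coeff r i + coeff s i ≡⟨ +-assoc _ _ _ ⟩
    coeff p i + (coeff r i + coeff s i) ≡⟨ cong (coeff p i +_) (sym (coeff-addL r s i)) ⟩
    coeff p i + coeff (addL r s) i    ≡⟨ sym (coeff-addL p (addL r s) i) ⟩
    coeff (addL p (addL r s)) i       ∎
    where open ≡-Reasoning

  addL-swap : ∀ p r s → addL p (addL r s) ≈ addL r (addL p s)
  addL-swap p r s = mk≈ λ i → begin
    coeff (addL p (addL r s)) i         ≡⟨ coeff-addL p (addL r s) i ⟩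
    coeff p i + coeff (addL r s) i      ≡⟨ cong (coeff p i +_) (coeff-addL r s i) ⟩
    coeff p i + (coeff r i + coeff s i) ≡⟨ +-swap _ _ _ ⟩
    coeff r i + (coeff p i + coeff s i) ≡⟨ cong (coeff r i +_) (sym (coeff-addL p s i)) ⟩
    coeff r i + coeff (addL p s) i      ≡⟨ sym (coeff-addL r (addL p s) i) ⟩
    coeff (addL r (addL p s)) i         ∎
    where open ≡-Reasoning

  addL-identityʳ : ∀ p {z} → z ≈ [] → addL p z ≈ p
  addL-identityʳ p {z} z≈[] = mk≈ λ i →
    trans (coeff-addL p z i) (trans (cong (coeff p i +_) (at z≈[] i)) (+-identityʳ _))

  mulL-zeroʳ : ∀ p → mulL p [] ≈ []
  mulL-zeroʳ p = mk≈ λ i → trans (coeff-mulL p [] i) (conv-zeroʳ (coeff p) (λ _ → refl) i)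

  mulL-distribʳ : ∀ p r s → mulL (addL p r) s ≈ addL (mulL p s) (mulL r s)
  mulL-distribʳ p r s = mk≈ λ i → begin
    coeff (mulL (addL p r) s) i                        ≡⟨ coeff-mulL (addL p r) s i ⟩
    conv (coeff (addL p r)) (coeff s) i                ≡⟨ conv-cong (coeff-addL p r) (λ _ → refl) i ⟩
    conv (λ j → coeff p j + coeff r j) (coeff s) i     ≡⟨ conv-distribʳ (coeff p) (coeff r) (coeff s) i ⟩
    conv (coeff p) (coeff s) i + conv (coeff r) (coeff s) i
      ≡⟨ sym (cong₂ _+_ (coeff-mulL p s i) (coeff-mulL r s i)) ⟩
    coeff (mulL p s) i + coeff (mulL r s) i            ≡⟨ sym (coeff-addL (mulL p s) (mulL r s) i) ⟩
    coeff (addL (mulL p s) (mulL r s)) i               ∎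
    where open ≡-Reasoning

  mulL-scaleˡ : ∀ c p r → mulL (scaleL c p) r ≈ scaleL c (mulL p r)
  mulL-scaleˡ c p r = mk≈ λ i → begin
    coeff (mulL (scaleL c p) r) i           ≡⟨ coeff-mulL (scaleL c p) r i ⟩
    conv (coeff (scaleL c p)) (coeff r) i   ≡⟨ conv-cong (coeff-scaleL c p) (λ _ → refl) i ⟩
    conv (λ j → c * coeff p j) (coeff r) i  ≡⟨ conv-scaleˡ c (coeff p) (coeff r) i ⟩
    c * conv (coeff p) (coeff r) i          ≡⟨ cong (c *_) (sym (coeff-mulL p r i)) ⟩
    c * coeff (mulL p r) i                  ≡⟨ sym (coeff-scaleL c (mulL p r) i) ⟩
    coeff (scaleL c (mulL p r)) i           ∎
    where open ≡-Reasoning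

  mulL-0∷ : ∀ p r → mulL (0# ∷ p) r ≈ 0# ∷ mulL p r
  mulL-0∷ p r = mk≈ λ i → trans (coeff-addL (scaleL 0# r) (0# ∷ mulL p r) i)
    (trans (cong (_+ coeff (0# ∷ mulL p r) i) (trans (coeff-scaleL 0# r i) (zeroˡ _))) (+-identityˡ _))

  mulL-constˡ : ∀ a p r → p ≈ [] → mulL (a ∷ p) r ≈ scaleL a r
  mulL-constˡ a p r p≈[] = addL-identityʳ (scaleL a r) (mk≈ tail≡0)
    where
    tail≡0 : ∀ i → coeff (0# ∷ mulL p r) i ≡ coeff [] i
    tail≡0 zero    = refl
    tail≡0 (suc i) = at (mulL-cong p≈[] (≈-refl {r})) i

  mulL-identityˡ : ∀ p → mulL one p ≈ p
  mulL-identityˡ p = ≈-trans (mulL-constˡ 1# [] p ≈-refl) (mk≈ λ i → trans (coeff-scaleL 1# p i) (*-identityˡ _))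

  mulL-consʳ : ∀ p b r → mulL p (b ∷ r) ≈ addL (scaleL b p) (0# ∷ mulL p r)
  mulL-consʳ []      b r = mk≈ λ { zero → refl ; (suc i) → refl }
  mulL-consʳ (a ∷ p) b r = ∷-≈ (cong (_+ 0#) (*-comm a b)) (begin
    addL (scaleL a r) (mulL p (b ∷ r))                     ≈⟨ addL-cong ≈-refl (mulL-consʳ p b r) ⟩
    addL (scaleL a r) (addL (scaleL b p) (0# ∷ mulL p r))  ≈⟨ addL-swap (scaleL a r) (scaleL b p) _ ⟩
    addL (scaleL b p) (addL (scaleL a r) (0# ∷ mulL p r))  ∎)
    where open SetoidReasoning ≈-setoid

  mulL-comm : ∀ p r → mulL p r ≈ mulL r p
  mulL-comm []      r = ≈-sym (mulL-zeroʳ r)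
  mulL-comm (a ∷ p) r = ≈-trans (addL-cong ≈-refl (∷-≈ refl (mulL-comm p r))) (≈-sym (mulL-consʳ r a p))

  mulL-assoc : ∀ p r s → mulL (mulL p r) s ≈ mulL p (mulL r s)
  mulL-assoc []      r s = ≈-refl
  mulL-assoc (a ∷ p) r s = begin
    mulL (addL (scaleL a r) (0# ∷ mulL p r)) s              ≈⟨ mulL-distribʳ (scaleL a r) _ s ⟩
    addL (mulL (scaleL a r) s) (mulL (0# ∷ mulL p r) s)     ≈⟨ addL-cong (mulL-scaleˡ a r s) (mulL-0∷ (mulL p r) s) ⟩
    addL (scaleL a (mulL r s)) (0# ∷ mulL (mulL p r) s)     ≈⟨ addL-cong ≈-refl (∷-≈ refl (mulL-assoc p r s)) ⟩
    addL (scaleL a (mulL r s)) (0# ∷ mulL p (mulL r s))     ∎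
    where open SetoidReasoning ≈-setoid

  mulL-distribˡ : ∀ p r s → mulL p (addL r s) ≈ addL (mulL p r) (mulL p s)
  mulL-distribˡ p r s = ≈-trans (mulL-comm p (addL r s))
    (≈-trans (mulL-distribʳ r s p) (addL-cong (mulL-comm r p) (mulL-comm s p)))

  mulL-scaleʳ : ∀ p c r → mulL p (scaleL c r) ≈ scaleL c (mulL p r)
  mulL-scaleʳ p c r = ≈-trans (mulL-comm p (scaleL c r)) (≈-trans (mulL-scaleˡ c r p) (scaleL-cong (mulL-comm r p)))

  mulL-swap : ∀ p r s → mulL p (mulL r s) ≈ mulL r (mulL p s)
  mulL-swap p r s = ≈-trans (≈-sym (mulL-assoc p r s)) (≈-trans (mulL-cong (mulL-comm p r) (≈-refl {s})) (mulL-assoc r p s))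

  coeff-mulL-∷ : ∀ a p q i → coeff (mulL (a ∷ p) q) i ≡ a * coeff q i + coeff (0# ∷ mulL p q) i
  coeff-mulL-∷ a p q i = trans (coeff-addL (scaleL a q) (0# ∷ mulL p q) i) (cong (_+ _) (coeff-scaleL a q i))

  mulL-degAtMost : ∀ p q dp dq → DegAtMost p dp → DegAtMost q dq → DegAtMost (mulL p q) (dp ℕ.+ dq)
  mulL-degAtMost []      q dp      dq p≤ q≤ i lt = refl
  mulL-degAtMost (a ∷ p) q zero    dq p≤ q≤ i lt =
    trans (at (mulL-constˡ a p q (mk≈ λ j → p≤ (suc j) (s≤s z≤n))) i)
      (trans (coeff-scaleL a q i) (trans (cong (a *_) (q≤ i lt)) (zeroʳ a)))
  mulL-degAtMost (a ∷ p) q (suc d) dq p≤ q≤ (suc i) (s≤s lt) = begin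
    coeff (mulL (a ∷ p) q) (suc i)      ≡⟨ coeff-mulL-∷ a p q (suc i) ⟩
    a * coeff q (suc i) + coeff (mulL p q) i
      ≡⟨ cong₂ _+_ (cong (a *_) (q≤ (suc i) (s≤s (ℕₚ.≤-trans (ℕₚ.m≤n+m dq d) (ℕₚ.<⇒≤ lt)))))
                   (mulL-degAtMost p q d dq (λ j lt′ → p≤ (suc j) (s≤s lt′)) q≤ i lt) ⟩
    a * 0# + 0#                         ≡⟨ trans (+-identityʳ _) (zeroʳ a) ⟩
    0#                                  ∎
    where open ≡-Reasoning

  coeff-mulL-top : ∀ p q dp dq → DegAtMost p dp → DegAtMost q dq →
                   coeff (mulL p q) (dp ℕ.+ dq) ≡ coeff p dp * coeff q dq
  coeff-mulL-top []      q dp      dq p≤ q≤ = sym (zeroˡ _)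
  coeff-mulL-top (a ∷ p) q zero    dq p≤ q≤ =
    trans (at (mulL-constˡ a p q (mk≈ λ j → p≤ (suc j) (s≤s z≤n))) dq) (coeff-scaleL a q dq)
  coeff-mulL-top (a ∷ p) q (suc d) dq p≤ q≤ = begin
    coeff (mulL (a ∷ p) q) (suc (d ℕ.+ dq))             ≡⟨ coeff-mulL-∷ a p q (suc (d ℕ.+ dq)) ⟩
    a * coeff q (suc (d ℕ.+ dq)) + coeff (mulL p q) (d ℕ.+ dq)
      ≡⟨ cong₂ _+_ (cong (a *_) (q≤ _ (s≤s (ℕₚ.m≤n+m dq d))))
                   (coeff-mulL-top p q d dq (λ j lt → p≤ (suc j) (s≤s lt)) q≤) ⟩
    a * 0# + coeff p d * coeff q dq                     ≡⟨ trans (cong (_+ coeff p d * coeff q dq) (zeroʳ a)) (+-identityˡ _) ⟩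
    coeff p d * coeff q dq                              ∎
    where open ≡-Reasoning

  module _ {p q : Pol} (p≢0 : Nonzero p) (q≢0 : Nonzero q) where
    private
      top : coeff (p ⊗ q) (deg p ℕ.+ deg q) ≡ lead p * lead q
      top = trans (coeff-strip (mulL p q) _) (trans
        (coeff-mulL-top p q (deg p) (deg q) (coeff-above-deg p) (coeff-above-deg q))
        (cong₂ _*_ (coeff-deg p) (coeff-deg q)))
      top≢0 : coeff (p ⊗ q) (deg p ℕ.+ deg q) ≢ 0#
      top≢0 eq = x≢0∧y≢0⇒x*y≢0 (lead≢0 p≢0) (lead≢0 q≢0) (trans (sym top) eq)
      ⊗≤ : DegAtMost (p ⊗ q) (deg p ℕ.+ deg q)
      ⊗≤ i lt = trans (coeff-strip (mulL p q) i)
        (mulL-degAtMost p q (deg p) (deg q) (coeff-above-deg p) (coeff-above-deg q) i lt)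

    ⊗-nonzero : Nonzero (p ⊗ q)
    ⊗-nonzero = nonzero-witness {p ⊗ q} top≢0

    deg-⊗ : deg (p ⊗ q) ≡ deg p ℕ.+ deg q
    deg-⊗ = deg-unique (p ⊗ q) ⊗≤ top≢0

    lead-⊗ : lead (p ⊗ q) ≡ lead p * lead q
    lead-⊗ = trans (lead-unique (p ⊗ q) ⊗≤ top≢0) top

    deg-mulL : deg (mulL p q) ≡ deg p ℕ.+ deg q
    deg-mulL = trans (sym (deg-cong (⊗-≈ p q))) deg-⊗

  mulL-nonzero⁻ : ∀ p q → Nonzero (mulL p q) → Nonzero p × Nonzero q
  mulL-nonzero⁻ p q pq≢0 =
    ¬≈[]⇒Nonzero (λ p≈[] → ≈[]⇒¬Nonzero (mulL-cong p≈[] (≈-refl {q})) pq≢0) ,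
    ¬≈[]⇒Nonzero (λ q≈[] → ≈[]⇒¬Nonzero (≈-trans (mulL-cong (≈-refl {p}) q≈[]) (mulL-zeroʳ p)) pq≢0)

  module _ {c p} (c≢0 : c ≢ 0#) (p≢0 : Nonzero p) where
    private
      top : coeff (scaleL c p) (deg p) ≡ c * lead p
      top = trans (coeff-scaleL c p (deg p)) (cong (c *_) (coeff-deg p))
      top≢0 : coeff (scaleL c p) (deg p) ≢ 0#
      top≢0 eq = x≢0∧y≢0⇒x*y≢0 c≢0 (lead≢0 p≢0) (trans (sym top) eq)
      scaled≤ : DegAtMost (scaleL c p) (deg p)
      scaled≤ i lt = trans (coeff-scaleL c p i) (trans (cong (c *_) (coeff-above-deg p i lt)) (zeroʳ c))

    scaleL-nonzero : Nonzero (scaleL c p)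
    scaleL-nonzero = nonzero-witness {scaleL c p} top≢0

    deg-scaleL : deg (scaleL c p) ≡ deg p
    deg-scaleL = deg-unique (scaleL c p) scaled≤ top≢0

    lead-scaleL : lead (scaleL c p) ≡ c * lead p
    lead-scaleL = trans (lead-unique (scaleL c p) scaled≤ top≢0) top

  coeff-shift-lo : ∀ m x i → i < m → coeff (replicate m 0# ++ x) i ≡ 0#
  coeff-shift-lo (suc m) x zero    _        = refl
  coeff-shift-lo (suc m) x (suc i) (s≤s lt) = coeff-shift-lo m x i lt

  coeff-shift-hi : ∀ m x j → coeff (replicate m 0# ++ x) (m ℕ.+ j) ≡ coeff x j
  coeff-shift-hi zero    x j = refl
  coeff-shift-hi (suc m) x j = coeff-shift-hi m x j

  coeff-shift-≥ : ∀ m x {i} → m ≤ i → coeff (replicate m 0# ++ x) i ≡ coeff x (i ∸ m)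
  coeff-shift-≥ m x m≤i = trans (cong (coeff (replicate m 0# ++ x)) (sym (ℕₚ.m+[n∸m]≡n m≤i))) (coeff-shift-hi m x _)

  mulL-T^ : ∀ m c → mulL (T^ m) c ≈ replicate m 0# ++ c
  mulL-T^ zero    c = mulL-identityˡ c
  mulL-T^ (suc m) c = ≈-trans (mulL-0∷ (T^ m) c) (∷-≈ refl (mulL-T^ m c))

  coeff-T^-< : ∀ m {i} → i < m → coeff (T^ m) i ≡ 0#
  coeff-T^-< m lt = coeff-shift-lo m (1# ∷ []) _ lt

  coeff-T^-≡ : ∀ m → coeff (T^ m) m ≡ 1#
  coeff-T^-≡ m = trans (cong (coeff (T^ m)) (sym (ℕₚ.+-identityʳ m))) (coeff-shift-hi m (1# ∷ []) 0)

  coeff-T^-> : ∀ m {i} → m < i → coeff (T^ m) i ≡ 0#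
  coeff-T^-> m {i} lt with i ∸ m | coeff-shift-≥ m (1# ∷ []) (ℕₚ.<⇒≤ lt) | ℕₚ.m<n⇒0<n∸m lt
  ... | suc _ | eq | _ = eq

  T^-nonzero : ∀ s → Nonzero (T^ s)
  T^-nonzero s = ∷ʳ-nonzero (replicate s 0#) 1≢0

  deg-T^ : ∀ s → deg (T^ s) ≡ s
  deg-T^ s = trans (deg-∷ʳ (replicate s 0#) 1≢0) (Listₚ.length-replicate s)

  one-normal : Normal one
  one-normal with 1# ≟ 0#
  ... | yes 1≡0 = ⊥-elim (0≢1 (sym 1≡0))
  ... | no  _   = refl

  lead≡1⇒Nonzero : ∀ {p} → lead p ≡ 1# → Nonzero p
  lead≡1⇒Nonzero {p} lead≡1 = nonzero λ eq → 0≢1 (trans (cong lastC (sym eq)) lead≡1)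

  lead-one : lead one ≡ 1#
  lead-one = cong lastC one-normal

  one-nonzero : Nonzero one
  one-nonzero = lead≡1⇒Nonzero lead-one

  deg-one : deg one ≡ 0
  deg-one = cong (λ s → length s ∸ 1) one-normal

  module _ {P} (P≢0 : Nonzero P) where
    ^P-nonzero : ∀ j → Nonzero (P ^P j)
    ^P-nonzero zero    = one-nonzero
    ^P-nonzero (suc j) = ⊗-nonzero P≢0 (^P-nonzero j)

    deg-^P : ∀ j → deg (P ^P j) ≡ j ℕ.* deg P
    deg-^P zero    = deg-one
    deg-^P (suc j) = trans (deg-⊗ P≢0 (^P-nonzero j)) (cong (deg P ℕ.+_) (deg-^P j))

  coeff₀-^P≢0 : ∀ P j → coeff (P ^P suc j) 0 ≢ 0# → coeff P 0 ≢ 0#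
  coeff₀-^P≢0 P j P^j₀≢0 P₀≡0 =
    P^j₀≢0 (trans (coeff₀-⊗ P (P ^P j)) (trans (cong (λ c → c * coeff (P ^P j) 0) P₀≡0) (zeroˡ _)))

  prodP-nonzero : ∀ {fs} → All Nonzero fs → Nonzero (prodP fs)
  prodP-nonzero []          = one-nonzero
  prodP-nonzero (f≢0 ∷ fs≢0) = ⊗-nonzero f≢0 (prodP-nonzero fs≢0)

  coeff₀-prodP≢0 : ∀ fs → coeff (prodP fs) 0 ≢ 0# → All (λ f → coeff f 0 ≢ 0#) fs
  coeff₀-prodP≢0 []       _  = []
  coeff₀-prodP≢0 (f ∷ fs) ≢0 =
    (λ f₀≡0 → ≢0 (trans (coeff₀-⊗ f (prodP fs)) (trans (cong (λ c → c * coeff (prodP fs) 0) f₀≡0) (zeroˡ _)))) ∷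
    coeff₀-prodP≢0 fs λ fs₀≡0 → ≢0 (trans (coeff₀-⊗ f (prodP fs)) (trans (cong (coeff f 0 *_) fs₀≡0) (zeroʳ _)))

module Reciprocal (F : FiniteField) where
  open FiniteField F
    renaming (_+_ to infixl 6 _+_; _*_ to infixl 7 _*_; -_ to infix 8 -_; _⁻¹ to infix 9 _⁻¹)
  open Poly F renaming (_⊖_ to infixl 6 _⊖_; _⊗_ to infixl 7 _⊗_; _^P_ to infixr 8 _^P_;
                        _* to infix 10 _*; _==_ to infix 4 _==_)
  open FieldFacts F
  open Coefficients F
  open Arithmetic F

  fromCoeffs : (ℕ → Carrier) → ℕ → Pol
  fromCoeffs f zero    = []
  fromCoeffs f (suc m) = f 0 ∷ fromCoeffs (λ i → f (suc i)) m

  coeff-fromCoeffs-< : ∀ f m {i} → i < m → coeff (fromCoeffs f m) i ≡ f i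
  coeff-fromCoeffs-< f (suc m) {zero}  _        = refl
  coeff-fromCoeffs-< f (suc m) {suc i} (s≤s lt) = coeff-fromCoeffs-< (λ i → f (suc i)) m lt

  coeff-fromCoeffs-≥ : ∀ f m {i} → m ≤ i → coeff (fromCoeffs f m) i ≡ 0#
  coeff-fromCoeffs-≥ f zero    _        = refl
  coeff-fromCoeffs-≥ f (suc m) (s≤s le) = coeff-fromCoeffs-≥ (λ i → f (suc i)) m le

  -- Rv N p = T^N p(1/T): the reversal of p regarded as a polynomial of degree N.
  Rv : ℕ → Pol → Pol
  Rv N p = fromCoeffs (λ i → coeff p (N ∸ i)) (suc N)

  coeff-Rv-≤ : ∀ N p {i} → i ≤ N → coeff (Rv N p) i ≡ coeff p (N ∸ i)
  coeff-Rv-≤ N p le = coeff-fromCoeffs-< (λ i → coeff p (N ∸ i)) (suc N) (s≤s le)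

  coeff-Rv-> : ∀ N p {i} → N < i → coeff (Rv N p) i ≡ 0#
  coeff-Rv-> N p lt = coeff-fromCoeffs-≥ (λ i → coeff p (N ∸ i)) (suc N) lt

  ≈-Rv : ∀ N p {r} → (∀ i → i ≤ N → coeff r i ≡ coeff p (N ∸ i)) → (∀ i → N < i → coeff r i ≡ 0#) →
         r ≈ Rv N p
  ≈-Rv N p {r} low high = mk≈ λ i → case i
    where
    case : ∀ i → coeff r i ≡ coeff (Rv N p) i
    case i with ℕₚ.≤-<-connex i N
    ... | inj₁ le = trans (low i le) (sym (coeff-Rv-≤ N p le))
    ... | inj₂ lt = trans (high i lt) (sym (coeff-Rv-> N p lt))

  Rv-cong : ∀ N {p r} → p ≈ r → Rv N p ≈ Rv N r
  Rv-cong N {p} {r} p≈r = ≈-Rv N r (λ i le → trans (coeff-Rv-≤ N p le) (at p≈r _)) (λ i → coeff-Rv-> N p)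

  Rv-zero : ∀ N → Rv N [] ≈ []
  Rv-zero N = ≈-sym (≈-Rv N [] (λ _ _ → refl) (λ _ _ → refl))

  Rv-addL : ∀ N p r → Rv N (addL p r) ≈ addL (Rv N p) (Rv N r)
  Rv-addL N p r = ≈-sym (≈-Rv N (addL p r)
    (λ i le → trans (coeff-addL (Rv N p) (Rv N r) i)
      (trans (cong₂ _+_ (coeff-Rv-≤ N p le) (coeff-Rv-≤ N r le)) (sym (coeff-addL p r _))))
    (λ i lt → trans (coeff-addL (Rv N p) (Rv N r) i)
      (trans (cong₂ _+_ (coeff-Rv-> N p lt) (coeff-Rv-> N r lt)) (+-identityʳ 0#))))

  Rv-scaleL : ∀ N a p → Rv N (scaleL a p) ≈ scaleL a (Rv N p)
  Rv-scaleL N a p = ≈-sym (≈-Rv N (scaleL a p)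
    (λ i le → trans (coeff-scaleL a (Rv N p) i) (trans (cong (a *_) (coeff-Rv-≤ N p le)) (sym (coeff-scaleL a p _))))
    (λ i lt → trans (coeff-scaleL a (Rv N p) i) (trans (cong (a *_) (coeff-Rv-> N p lt)) (zeroʳ a))))

  Rv-0∷ : ∀ N p → Rv (suc N) (0# ∷ p) ≈ Rv N p
  Rv-0∷ N p = ≈-sym (≈-Rv (suc N) (0# ∷ p) low high)
    where
    low : ∀ i → i ≤ suc N → coeff (Rv N p) i ≡ coeff (0# ∷ p) (suc N ∸ i)
    low i le with ℕₚ.m≤n⇒m<n∨m≡n le
    ... | inj₁ (s≤s le′) = trans (coeff-Rv-≤ N p le′) (cong (coeff (0# ∷ p)) (sym (ℕₚ.+-∸-assoc 1 le′)))
    ... | inj₂ refl      = trans (coeff-Rv-> N p (ℕₚ.n<1+n N)) (cong (coeff (0# ∷ p)) (sym (ℕₚ.n∸n≡0 (suc N))))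
    high : ∀ i → suc N < i → coeff (Rv N p) i ≡ 0#
    high i lt = coeff-Rv-> N p (ℕₚ.<-trans (ℕₚ.n<1+n N) lt)

  Rv-∷ : ∀ d a p → Rv (suc d) (a ∷ p) ≈ addL (Rv d p) (scaleL a (T^ (suc d)))
  Rv-∷ d a p = ≈-sym (≈-Rv (suc d) (a ∷ p) low high)
    where
    rhs : ∀ i → coeff (addL (Rv d p) (scaleL a (T^ (suc d)))) i ≡ coeff (Rv d p) i + a * coeff (T^ (suc d)) i
    rhs i = trans (coeff-addL (Rv d p) (scaleL a (T^ (suc d))) i) (cong (coeff (Rv d p) i +_) (coeff-scaleL a (T^ (suc d)) i))
    low : ∀ i → i ≤ suc d → coeff (addL (Rv d p) (scaleL a (T^ (suc d)))) i ≡ coeff (a ∷ p) (suc d ∸ i)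
    low i le with ℕₚ.m≤n⇒m<n∨m≡n le
    ... | inj₁ (s≤s le′) = trans (rhs i) (trans
      (cong₂ _+_ (coeff-Rv-≤ d p le′) (trans (cong (a *_) (coeff-T^-< (suc d) (s≤s le′))) (zeroʳ a)))
      (trans (+-identityʳ _) (cong (coeff (a ∷ p)) (sym (ℕₚ.+-∸-assoc 1 le′)))))
    ... | inj₂ refl = trans (rhs (suc d)) (trans
      (cong₂ _+_ (coeff-Rv-> d p (ℕₚ.n<1+n d)) (trans (cong (a *_) (coeff-T^-≡ (suc d))) (*-identityʳ a)))
      (trans (+-identityˡ a) (cong (coeff (a ∷ p)) (sym (ℕₚ.n∸n≡0 (suc d))))))
    high : ∀ i → suc d < i → coeff (addL (Rv d p) (scaleL a (T^ (suc d)))) i ≡ 0#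
    high i lt = trans (rhs i) (trans
      (cong₂ _+_ (coeff-Rv-> d p (ℕₚ.<-trans (ℕₚ.n<1+n d) lt)) (trans (cong (a *_) (coeff-T^-> (suc d) lt)) (zeroʳ a)))
      (+-identityˡ 0#))

  Rv-+ : ∀ m e p → DegAtMost p e → Rv (m ℕ.+ e) p ≈ replicate m 0# ++ Rv e p
  Rv-+ m e p p≤e = ≈-sym (≈-Rv (m ℕ.+ e) p low high)
    where
    low : ∀ i → i ≤ m ℕ.+ e → coeff (replicate m 0# ++ Rv e p) i ≡ coeff p (m ℕ.+ e ∸ i)
    low i le with ℕₚ.<-≤-connex i m
    ... | inj₁ i<m = trans (coeff-shift-lo m _ i i<m) (sym (p≤e _ e<))
      where
      e< : e < m ℕ.+ e ∸ i
      e< = subst (e <_) (sym (ℕₚ.+-∸-comm e (ℕₚ.<⇒≤ i<m))) (ℕₚ.+-monoˡ-≤ e (ℕₚ.m<n⇒0<n∸m i<m))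
    ... | inj₂ m≤i = trans (coeff-shift-≥ m (Rv e p) m≤i) (trans
      (coeff-Rv-≤ e p (subst (i ∸ m ≤_) (ℕₚ.m+n∸m≡n m e) (ℕₚ.∸-monoˡ-≤ m le)))
      (cong (coeff p) (trans (sym (ℕₚ.[m+n]∸[m+o]≡n∸o m e (i ∸ m))) (cong (m ℕ.+ e ∸_) (ℕₚ.m+[n∸m]≡n m≤i)))))
    high : ∀ i → m ℕ.+ e < i → coeff (replicate m 0# ++ Rv e p) i ≡ 0#
    high i lt = trans (coeff-shift-≥ m (Rv e p) m≤i) (coeff-Rv-> e p e<)
      where
      m≤i = ℕₚ.≤-trans (ℕₚ.m≤m+n m e) (ℕₚ.<⇒≤ lt)
      e< : e < i ∸ m
      e< = subst (_< i ∸ m) (ℕₚ.m+n∸m≡n m e) (ℕₚ.∸-monoˡ-< lt (ℕₚ.m≤m+n m e))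

  Rv-mulL : ∀ p q d e → DegAtMost p d → DegAtMost q e → Rv (d ℕ.+ e) (mulL p q) ≈ mulL (Rv d p) (Rv e q)
  Rv-mulL []      q d       e p≤ q≤ =
    ≈-trans (Rv-zero (d ℕ.+ e)) (≈-sym (mulL-cong (Rv-zero d) (≈-refl {Rv e q})))
  Rv-mulL (a ∷ p) q zero    e p≤ q≤ = begin
    Rv e (mulL (a ∷ p) q)  ≈⟨ Rv-cong e (mulL-constˡ a p q (mk≈ λ i → p≤ (suc i) (s≤s z≤n))) ⟩
    Rv e (scaleL a q)      ≈⟨ Rv-scaleL e a q ⟩
    scaleL a (Rv e q)      ≈⟨ mulL-constˡ a [] (Rv e q) ≈-refl ⟨
    mulL (a ∷ []) (Rv e q) ∎
    where open SetoidReasoning ≈-setoid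
  Rv-mulL (a ∷ p) q (suc d) e p≤ q≤ = begin
    Rv (suc d ℕ.+ e) (addL (scaleL a q) (0# ∷ mulL p q))
      ≈⟨ Rv-addL (suc d ℕ.+ e) (scaleL a q) (0# ∷ mulL p q) ⟩
    addL (Rv (suc d ℕ.+ e) (scaleL a q)) (Rv (suc d ℕ.+ e) (0# ∷ mulL p q))
      ≈⟨ addL-cong (Rv-scaleL (suc d ℕ.+ e) a q) (Rv-0∷ (d ℕ.+ e) (mulL p q)) ⟩
    addL (scaleL a (Rv (suc d ℕ.+ e) q)) (Rv (d ℕ.+ e) (mulL p q))
      ≈⟨ addL-cong (scaleL-cong (≈-trans (Rv-+ (suc d) e q q≤) (≈-sym (mulL-T^ (suc d) (Rv e q)))))
                   (Rv-mulL p q d e (λ i lt → p≤ (suc i) (s≤s lt)) q≤) ⟩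
    addL (scaleL a (mulL (T^ (suc d)) (Rv e q))) (mulL (Rv d p) (Rv e q))
      ≈⟨ addL-comm (scaleL a (mulL (T^ (suc d)) (Rv e q))) (mulL (Rv d p) (Rv e q)) ⟩
    addL (mulL (Rv d p) (Rv e q)) (scaleL a (mulL (T^ (suc d)) (Rv e q)))
      ≈⟨ addL-cong (≈-refl {mulL (Rv d p) (Rv e q)}) (mulL-scaleˡ a (T^ (suc d)) (Rv e q)) ⟨
    addL (mulL (Rv d p) (Rv e q)) (mulL (scaleL a (T^ (suc d))) (Rv e q))
      ≈⟨ mulL-distribʳ (Rv d p) (scaleL a (T^ (suc d))) (Rv e q) ⟨
    mulL (addL (Rv d p) (scaleL a (T^ (suc d)))) (Rv e q)
      ≈⟨ mulL-cong (Rv-∷ d a p) (≈-refl {Rv e q}) ⟨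
    mulL (Rv (suc d) (a ∷ p)) (Rv e q) ∎
    where open SetoidReasoning ≈-setoid

  coeff-reverse-< : ∀ s {i} → i < length s → coeff (reverse s) i ≡ coeff s (length s ∸ suc i)
  coeff-reverse-< (a ∷ s) {i} lt rewrite Listₚ.unfold-reverse a s with ℕₚ.m<1+n⇒m<n∨m≡n lt
  ... | inj₁ i<len = trans (coeff-++-< (reverse s) (subst (i <_) (sym (Listₚ.length-reverse s)) i<len))
    (trans (coeff-reverse-< s i<len) (cong (coeff (a ∷ s)) (sym (ℕₚ.+-∸-assoc 1 i<len))))
  ... | inj₂ refl = trans (cong (coeff (reverse s ++ a ∷ [])) (sym (Listₚ.length-reverse s)))
    (trans (coeff-++-length (reverse s) (a ∷ [])) (cong (coeff (a ∷ s)) (sym (ℕₚ.n∸n≡0 (length s)))))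

  coeff-reverse-≥ : ∀ s {i} → length s ≤ i → coeff (reverse s) i ≡ 0#
  coeff-reverse-≥ s {i} le = coeff-length (reverse s) i (subst (_≤ i) (sym (Listₚ.length-reverse s)) le)

  reverse-≈-Rv : ∀ s → reverse s ≈ Rv (length s ∸ 1) s
  reverse-≈-Rv []      = ≈-sym (Rv-zero 0)
  reverse-≈-Rv (a ∷ s) = ≈-Rv (length s) (a ∷ s)
    (λ i le → coeff-reverse-< (a ∷ s) (s≤s le)) (λ i lt → coeff-reverse-≥ (a ∷ s) lt)

  *-≈-Rv : ∀ g → g * ≈ Rv (deg g) g
  *-≈-Rv g = ≈-trans (strip-≈ (reverse (strip g)))
    (≈-trans (reverse-≈-Rv (strip g)) (Rv-cong (deg g) (strip-≈ g)))

  coeff-*-≤ : ∀ g {i} → i ≤ deg g → coeff (g *) i ≡ coeff g (deg g ∸ i)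
  coeff-*-≤ g le = trans (at (*-≈-Rv g) _) (coeff-Rv-≤ (deg g) g le)

  coeff-*-> : ∀ g {i} → deg g < i → coeff (g *) i ≡ 0#
  coeff-*-> g lt = trans (at (*-≈-Rv g) _) (coeff-Rv-> (deg g) g lt)

  *-cong : ∀ {p r} → p ≈ r → p * ≡ r *
  *-cong p≈r = cong (λ s → strip (reverse s)) (strip-cong p≈r)

  *-normal : ∀ g → Normal (g *)
  *-normal g = strip-normal (reverse (strip g))

  coeff₀-* : ∀ g → coeff (g *) 0 ≡ lead g
  coeff₀-* g = trans (coeff-*-≤ g z≤n) (coeff-deg g)

  *-nonzero : ∀ {g} → Nonzero g → Nonzero (g *)
  *-nonzero {g} g≢0 = nonzero-witness {g *} {0} λ eq → lead≢0 g≢0 (trans (sym (coeff₀-* g)) eq)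

  *-⊗ : ∀ {a b} → Nonzero a → Nonzero b → (a ⊗ b) * ≈ a * ⊗ b *
  *-⊗ {a} {b} a≢0 b≢0 = begin
    (a ⊗ b) *                          ≈⟨ *-≈-Rv (a ⊗ b) ⟩
    Rv (deg (a ⊗ b)) (a ⊗ b)           ≡⟨ cong (λ N → Rv N (a ⊗ b)) (deg-⊗ a≢0 b≢0) ⟩
    Rv (deg a ℕ.+ deg b) (a ⊗ b)       ≈⟨ Rv-cong _ (⊗-≈ a b) ⟩
    Rv (deg a ℕ.+ deg b) (mulL a b)    ≈⟨ Rv-mulL a b (deg a) (deg b) (coeff-above-deg a) (coeff-above-deg b) ⟩
    mulL (Rv (deg a) a) (Rv (deg b) b) ≈⟨ mulL-cong (*-≈-Rv a) (*-≈-Rv b) ⟨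
    mulL (a *) (b *)                   ≈⟨ ⊗-≈ (a *) (b *) ⟨
    a * ⊗ b *                          ∎
    where open SetoidReasoning ≈-setoid

  module _ {g} (g≢0 : Nonzero g) (g₀≢0 : coeff g 0 ≢ 0#) where
    private
      top : coeff (g *) (deg g) ≡ coeff g 0
      top = trans (coeff-*-≤ g ℕₚ.≤-refl) (cong (coeff g) (ℕₚ.n∸n≡0 (deg g)))
      top≢0 : coeff (g *) (deg g) ≢ 0#
      top≢0 eq = g₀≢0 (trans (sym top) eq)

    deg-* : deg (g *) ≡ deg g
    deg-* = deg-unique (g *) (λ i → coeff-*-> g) top≢0

    lead-* : lead (g *) ≡ coeff g 0
    lead-* = trans (lead-unique (g *) (λ i → coeff-*-> g) top≢0) top

    *-involutive : (g *) * ≈ g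
    *-involutive = mk≈ λ i → case i
      where
      case : ∀ i → coeff ((g *) *) i ≡ coeff g i
      case i with ℕₚ.≤-<-connex i (deg g)
      ... | inj₁ le = begin
        coeff ((g *) *) i            ≡⟨ coeff-*-≤ (g *) (subst (i ≤_) (sym deg-*) le) ⟩
        coeff (g *) (deg (g *) ∸ i)  ≡⟨ cong (λ d → coeff (g *) (d ∸ i)) deg-* ⟩
        coeff (g *) (deg g ∸ i)      ≡⟨ coeff-*-≤ g (ℕₚ.m∸n≤m (deg g) i) ⟩
        coeff g (deg g ∸ (deg g ∸ i)) ≡⟨ cong (coeff g) (ℕₚ.m∸[m∸n]≡n le) ⟩
        coeff g i                    ∎
        where open ≡-Reasoning
      ... | inj₂ lt = trans (coeff-*-> (g *) (subst (_< i) (sym deg-*) lt)) (sym (coeff-above-deg g i lt))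

  *-scaleL : ∀ {c y} → c ≢ 0# → Nonzero y → (scaleL c y) * ≈ scaleL c (y *)
  *-scaleL {c} {y} c≢0 y≢0 = begin
    (scaleL c y) *                   ≈⟨ *-≈-Rv (scaleL c y) ⟩
    Rv (deg (scaleL c y)) (scaleL c y) ≡⟨ cong (λ N → Rv N (scaleL c y)) (deg-scaleL c≢0 y≢0) ⟩
    Rv (deg y) (scaleL c y)          ≈⟨ Rv-scaleL (deg y) c y ⟩
    scaleL c (Rv (deg y) y)          ≈⟨ scaleL-cong (*-≈-Rv y) ⟨
    scaleL c (y *)                   ∎
    where open SetoidReasoning ≈-setoid

  coeff-monicize : ∀ f i → coeff (monicize f) i ≡ lead f ⁻¹ * coeff f i
  coeff-monicize f i = trans (coeff-strip (scaleL (lead f ⁻¹) f) i) (coeff-scaleL (lead f ⁻¹) f i)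

  monicize-cong : ∀ {p r} → p ≈ r → monicize p ≡ monicize r
  monicize-cong {p} {r} p≈r rewrite lead-cong p≈r = strip-cong (scaleL-cong p≈r)

  monicize-normal : ∀ f → Normal (monicize f)
  monicize-normal f = strip-normal (scaleL (lead f ⁻¹) f)

  module _ {f} (f≢0 : Nonzero f) where
    private
      c≢0 : lead f ⁻¹ ≢ 0#
      c≢0 = ⁻¹-≢0 (lead≢0 f≢0)

    deg-monicize : deg (monicize f) ≡ deg f
    deg-monicize = trans (deg-cong (strip-≈ (scaleL (lead f ⁻¹) f))) (deg-scaleL c≢0 f≢0)

    lead-monicize : lead (monicize f) ≡ 1#
    lead-monicize = trans (lead-cong (strip-≈ (scaleL (lead f ⁻¹) f)))
      (trans (lead-scaleL c≢0 f≢0) (inverseˡ (lead f) (lead≢0 f≢0)))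

  monicize-id : ∀ {f} → Normal f → lead f ≡ 1# → monicize f ≡ f
  monicize-id {f} f-normal lead≡1 = ≈⇒≡ (monicize-normal f) f-normal (mk≈ λ i →
    trans (coeff-monicize f i) (trans (cong (λ c → c ⁻¹ * coeff f i) lead≡1)
      (trans (cong (λ c → c * coeff f i) 1⁻¹≡1) (*-identityˡ _))))

  monicize-⊗ : ∀ {u v} → Nonzero u → Nonzero v → monicize (u ⊗ v) ≡ monicize u ⊗ monicize v
  monicize-⊗ {u} {v} u≢0 v≢0 =
    ≈⇒≡ (monicize-normal (u ⊗ v)) (strip-normal (mulL (monicize u) (monicize v))) (mk≈ λ i → begin
      coeff (monicize (u ⊗ v)) i
        ≡⟨ coeff-monicize (u ⊗ v) i ⟩
      lead (u ⊗ v) ⁻¹ * coeff (u ⊗ v) i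
        ≡⟨ cong₂ (λ a b → a ⁻¹ * b) (lead-⊗ u≢0 v≢0) (coeff-⊗ u v i) ⟩
      (lead u * lead v) ⁻¹ * conv (coeff u) (coeff v) i
        ≡⟨ cong (λ c → c * conv (coeff u) (coeff v) i) (⁻¹-distrib-* (lead≢0 u≢0) (lead≢0 v≢0)) ⟩
      lead u ⁻¹ * lead v ⁻¹ * conv (coeff u) (coeff v) i
        ≡⟨ *-assoc _ _ _ ⟩
      lead u ⁻¹ * (lead v ⁻¹ * conv (coeff u) (coeff v) i)
        ≡⟨ cong (lead u ⁻¹ *_) (sym (conv-scaleʳ (lead v ⁻¹) (coeff u) (coeff v) i)) ⟩
      lead u ⁻¹ * conv (coeff u) (λ j → lead v ⁻¹ * coeff v j) i
        ≡⟨ sym (conv-scaleˡ (lead u ⁻¹) (coeff u) _ i) ⟩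
      conv (λ j → lead u ⁻¹ * coeff u j) (λ j → lead v ⁻¹ * coeff v j) i
        ≡⟨ conv-cong (λ j → sym (coeff-monicize u j)) (λ j → sym (coeff-monicize v j)) i ⟩
      conv (coeff (monicize u)) (coeff (monicize v)) i
        ≡⟨ sym (coeff-⊗ (monicize u) (monicize v) i) ⟩
      coeff (monicize u ⊗ monicize v) i ∎)
    where open ≡-Reasoning

  monicize-scaleL : ∀ {c f} → c ≢ 0# → Nonzero f → monicize (scaleL c f) ≡ monicize f
  monicize-scaleL {c} {f} c≢0 f≢0 = ≈⇒≡ (monicize-normal (scaleL c f)) (monicize-normal f) (mk≈ λ i → begin
    coeff (monicize (scaleL c f)) i                ≡⟨ coeff-monicize (scaleL c f) i ⟩
    lead (scaleL c f) ⁻¹ * coeff (scaleL c f) i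
      ≡⟨ cong₂ (λ a b → a ⁻¹ * b) (lead-scaleL c≢0 f≢0) (coeff-scaleL c f i) ⟩
    (c * lead f) ⁻¹ * (c * coeff f i)
      ≡⟨ cong (λ a → a * (c * coeff f i)) (⁻¹-distrib-* c≢0 (lead≢0 f≢0)) ⟩
    c ⁻¹ * lead f ⁻¹ * (c * coeff f i)             ≡⟨ *-interchange _ _ _ _ ⟩
    c ⁻¹ * c * (lead f ⁻¹ * coeff f i)             ≡⟨ cong (λ a → a * (lead f ⁻¹ * coeff f i)) (inverseˡ c c≢0) ⟩
    1# * (lead f ⁻¹ * coeff f i)                   ≡⟨ *-identityˡ _ ⟩
    lead f ⁻¹ * coeff f i                          ≡⟨ coeff-monicize f i ⟨
    coeff (monicize f) i                           ∎)
    where open ≡-Reasoning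

  -- Λk k (f *) unfolds to Λmon k (ρ f).
  ρ : Pol → Pol
  ρ f = monicize (f *)

  ρ-cong : ∀ {p r} → p ≈ r → ρ p ≡ ρ r
  ρ-cong p≈r = cong monicize (*-cong p≈r)

  ρ-⊗ : ∀ {a b} → Nonzero a → Nonzero b → ρ (a ⊗ b) ≡ ρ a ⊗ ρ b
  ρ-⊗ a≢0 b≢0 = trans (monicize-cong (*-⊗ a≢0 b≢0)) (monicize-⊗ (*-nonzero a≢0) (*-nonzero b≢0))

  ρ-one : ρ one ≡ one
  ρ-one = trans (cong (λ s → monicize (strip (reverse s))) one-normal)
                (trans (cong monicize one-normal) (monicize-id one-normal lead-one))

  ρ-^P : ∀ {P} → Nonzero P → ∀ j → ρ (P ^P j) ≡ ρ P ^P j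
  ρ-^P P≢0 zero    = ρ-one
  ρ-^P {P} P≢0 (suc j) = trans (ρ-⊗ P≢0 (^P-nonzero P≢0 j)) (cong (ρ P ⊗_) (ρ-^P P≢0 j))

  ρ-prodP : ∀ {fs} → All Nonzero fs → ρ (prodP fs) ≡ prodP (map ρ fs)
  ρ-prodP []                      = ρ-one
  ρ-prodP {f ∷ fs} (f≢0 ∷ fs≢0) = trans (ρ-⊗ f≢0 (prodP-nonzero fs≢0)) (cong (ρ f ⊗_) (ρ-prodP fs≢0))

  deg-ρ : ∀ {f} → Nonzero f → coeff f 0 ≢ 0# → deg (ρ f) ≡ deg f
  deg-ρ f≢0 f₀≢0 = trans (deg-monicize (*-nonzero f≢0)) (deg-* f≢0 f₀≢0)

  coeff₀-ρ≢0 : ∀ {f} → Nonzero f → coeff f 0 ≢ 0# → coeff (ρ f) 0 ≢ 0#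
  coeff₀-ρ≢0 {f} f≢0 f₀≢0 eq =
    x≢0∧y≢0⇒x*y≢0 (⁻¹-≢0 lead*≢0) (λ c → lead≢0 f≢0 (trans (sym (coeff₀-* f)) c))
    (trans (sym (coeff-monicize (f *) 0)) eq)
    where
    lead*≢0 : lead (f *) ≢ 0#
    lead*≢0 = lead≢0 (*-nonzero f≢0)

  record MonicT∤ (f : Pol) : Set where
    field
      normal   : Normal f
      lead≡1   : lead f ≡ 1#
      coeff₀≢0 : coeff f 0 ≢ 0#

    nonzero′ : Nonzero f
    nonzero′ = lead≡1⇒Nonzero lead≡1

  deg-ρ-monicT∤ : ∀ {f} → MonicT∤ f → deg (ρ f) ≡ deg f
  deg-ρ-monicT∤ m = deg-ρ (MonicT∤.nonzero′ m) (MonicT∤.coeff₀≢0 m)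

  ρ-monicT∤ : ∀ {f} → MonicT∤ f → MonicT∤ (ρ f)
  ρ-monicT∤ {f} m = record
    { normal   = monicize-normal (f *)
    ; lead≡1   = lead-monicize (*-nonzero nonzero′)
    ; coeff₀≢0 = coeff₀-ρ≢0 nonzero′ coeff₀≢0 }
    where open MonicT∤ m

  ρ-involutive : ∀ {f} → MonicT∤ f → ρ (ρ f) ≡ f
  ρ-involutive {f} m = begin
    monicize ((monicize (f *)) *)         ≡⟨ cong monicize (*-cong (strip-≈ (scaleL c (f *)))) ⟩
    monicize ((scaleL c (f *)) *)         ≡⟨ monicize-cong (*-scaleL c≢0 f*≢0) ⟩
    monicize (scaleL c ((f *) *))         ≡⟨ monicize-scaleL c≢0 (*-nonzero f*≢0) ⟩
    monicize ((f *) *)                    ≡⟨ monicize-cong (*-involutive nonzero′ coeff₀≢0) ⟩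
    monicize f                            ≡⟨ monicize-id normal lead≡1 ⟩
    f                                     ∎
    where
    open ≡-Reasoning
    open MonicT∤ m
    f*≢0 = *-nonzero nonzero′
    c = lead (f *) ⁻¹
    c≢0 : c ≢ 0#
    c≢0 = ⁻¹-≢0 (lead≢0 f*≢0)

module Divisibility (F : FiniteField) where
  open FiniteField F
    renaming (_+_ to infixl 6 _+_; _*_ to infixl 7 _*_; -_ to infix 8 -_; _⁻¹ to infix 9 _⁻¹)
  open Poly F renaming (_⊖_ to infixl 6 _⊖_; _⊗_ to infixl 7 _⊗_; _^P_ to infixr 8 _^P_;
                        _* to infix 10 _*; _==_ to infix 4 _==_)
  open FieldFacts F
  open Coefficients F
  open Arithmetic F
  open Reciprocal F

  infixl 6 _−_
  _−_ : Pol → Pol → Pol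
  p − r = addL p (scaleL (- 1#) r)

  coeff-− : ∀ p r i → coeff (p − r) i ≡ coeff p i + - 1# * coeff r i
  coeff-− p r i = trans (coeff-addL p _ i) (cong (coeff p i +_) (coeff-scaleL (- 1#) r i))

  −-+-cancel : ∀ p r → addL (p − r) r ≈ p
  −-+-cancel p r = mk≈ λ i → trans (coeff-addL (p − r) r i)
    (trans (cong (_+ coeff r i) (coeff-− p r i)) ([x+-1*y]+y≡x _ _))

  ≈-+⇒−-≈ : ∀ {p q r} → p ≈ addL q r → r ≈ p − q
  ≈-+⇒−-≈ {p} {q} {r} p≈q+r = mk≈ λ i → sym (begin
    coeff (p − q) i                        ≡⟨ coeff-− p q i ⟩
    coeff p i + - 1# * coeff q i           ≡⟨ cong (_+ - 1# * coeff q i) (trans (at p≈q+r i) (coeff-addL q r i)) ⟩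
    coeff q i + coeff r i + - 1# * coeff q i ≡⟨ cong (_+ - 1# * coeff q i) (+-comm _ _) ⟩
    coeff r i + coeff q i + - 1# * coeff q i ≡⟨ +-assoc _ _ _ ⟩
    coeff r i + (coeff q i + - 1# * coeff q i) ≡⟨ cong (coeff r i +_) (x+-1*x≡0 _) ⟩
    coeff r i + 0#                         ≡⟨ +-identityʳ _ ⟩
    coeff r i                              ∎)
    where open ≡-Reasoning

  mulL-distribˡ-− : ∀ p r s → mulL p (r − s) ≈ mulL p r − mulL p s
  mulL-distribˡ-− p r s = ≈-trans (mulL-distribˡ p r _) (addL-cong (≈-refl {mulL p r}) (mulL-scaleʳ p (- 1#) s))

  mulL-distribʳ-− : ∀ p r s → mulL (p − r) s ≈ mulL p s − mulL r s
  mulL-distribʳ-− p r s = ≈-trans (mulL-distribʳ p _ s) (addL-cong (≈-refl {mulL p s}) (mulL-scaleˡ (- 1#) r s))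

  coeff-T^-mulL : ∀ m a {i} → m ≤ i → coeff (mulL (T^ m) a) i ≡ coeff a (i ∸ m)
  coeff-T^-mulL m a m≤i = trans (at (mulL-T^ m a) _) (coeff-shift-≥ m a m≤i)

  record DivMod (p a : Pol) : Set where
    constructor divMod
    field
      quotient remainder : Pol
      p≈qa+r     : p ≈ addL (mulL quotient a) remainder
      remainder< : DegBelow remainder (deg a)

  leadingQuotient : Pol → Pol → ℕ → Pol
  leadingQuotient p a n = scaleL (coeff p n * lead a ⁻¹) (T^ (n ∸ deg a))

  divide-step : ∀ {p a n} → Nonzero a → deg a ≤ n → DegBelow p (suc n) →
                DegBelow (p − mulL (leadingQuotient p a n) a) n
  divide-step {p} {a} {n} a≢0 a≤n p<n i n≤i = begin
    coeff (p − mulL (leadingQuotient p a n) a) i            ≡⟨ coeff-− p _ i ⟩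
    coeff p i + - 1# * coeff (mulL (scaleL c (T^ m)) a) i  ≡⟨ cong (λ x → coeff p i + - 1# * x) Xᵢ ⟩
    coeff p i + - 1# * (c * coeff a (i ∸ m))               ≡⟨ case (ℕₚ.m≤n⇒m<n∨m≡n n≤i) ⟩
    0#                                                     ∎
    where
    open ≡-Reasoning
    m = n ∸ deg a
    c = coeff p n * lead a ⁻¹
    Xᵢ : coeff (mulL (scaleL c (T^ m)) a) i ≡ c * coeff a (i ∸ m)
    Xᵢ = trans (at (mulL-scaleˡ c (T^ m) a) i) (trans (coeff-scaleL c (mulL (T^ m) a) i)
           (cong (c *_) (coeff-T^-mulL m a (ℕₚ.≤-trans (ℕₚ.m∸n≤m n (deg a)) n≤i))))
    case : n < i ⊎ n ≡ i → coeff p i + - 1# * (c * coeff a (i ∸ m)) ≡ 0#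
    case (inj₂ refl) = begin
      coeff p n + - 1# * (c * coeff a (n ∸ m))
        ≡⟨ cong (λ j → coeff p n + - 1# * (c * coeff a j)) (ℕₚ.m∸[m∸n]≡n a≤n) ⟩
      coeff p n + - 1# * (c * coeff a (deg a))  ≡⟨ cong (λ x → coeff p n + - 1# * (c * x)) (coeff-deg a) ⟩
      coeff p n + - 1# * (c * lead a)           ≡⟨ cong (λ x → coeff p n + - 1# * x) c*lead≡ ⟩
      coeff p n + - 1# * coeff p n              ≡⟨ x+-1*x≡0 _ ⟩
      0#                                        ∎
      where
      c*lead≡ : c * lead a ≡ coeff p n
      c*lead≡ = trans (*-assoc _ _ _) (trans (cong (coeff p n *_) (inverseˡ (lead a) (lead≢0 a≢0))) (*-identityʳ _))
    case (inj₁ n<i) = begin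
      coeff p i + - 1# * (c * coeff a (i ∸ m))  ≡⟨ cong₂ (λ x y → x + - 1# * (c * y)) (p<n i n<i) (coeff-above-deg a _ a<) ⟩
      0# + - 1# * (c * 0#)                      ≡⟨ trans (+-identityˡ _) (trans (cong (- 1# *_) (zeroʳ c)) (zeroʳ _)) ⟩
      0#                                        ∎
      where
      a< : deg a < i ∸ m
      a< = subst (_< i ∸ m) (ℕₚ.m∸[m∸n]≡n a≤n) (ℕₚ.∸-monoˡ-< n<i (ℕₚ.m∸n≤m n (deg a)))

  -- n bounds the length of the dividend and drops by one per step.
  divide : ∀ {a} → Nonzero a → ∀ n {p} → DegBelow p n → DivMod p a
  divide {a} a≢0 n {p} p<n with ℕₚ.≤-<-connex n (deg a)
  ... | inj₁ n≤a = divMod [] p ≈-refl (λ i le → p<n i (ℕₚ.≤-trans n≤a le))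
  divide {a} a≢0 (suc n) {p} p<n | inj₂ (s≤s a≤n) with divide a≢0 n (divide-step {p} a≢0 a≤n p<n)
  ... | divMod s r p′≈sa+r r< = divMod (addL s t) r p≈ r<
    where
    t = leadingQuotient p a n
    p≈ : p ≈ addL (mulL (addL s t) a) r
    p≈ = begin
      p                                         ≈⟨ −-+-cancel p (mulL t a) ⟨
      addL (p − mulL t a) (mulL t a)            ≈⟨ addL-cong p′≈sa+r (≈-refl {mulL t a}) ⟩
      addL (addL (mulL s a) r) (mulL t a)       ≈⟨ addL-assoc (mulL s a) r (mulL t a) ⟩
      addL (mulL s a) (addL r (mulL t a))       ≈⟨ addL-cong (≈-refl {mulL s a}) (addL-comm r (mulL t a)) ⟩
      addL (mulL s a) (addL (mulL t a) r)       ≈⟨ addL-assoc (mulL s a) (mulL t a) r ⟨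
      addL (addL (mulL s a) (mulL t a)) r       ≈⟨ addL-cong (mulL-distribʳ s t a) (≈-refl {r}) ⟨
      addL (mulL (addL s t) a) r                ∎
      where open SetoidReasoning ≈-setoid

  record Irreducible (P : Pol) : Set where
    field
      nonconstant : 1 ≤ deg P
      no-factors  : ∀ a b → 1 ≤ deg a → 1 ≤ deg b → mulL a b ≈ P → ⊥

  1≤deg⇒Nonzero : ∀ {p} → 1 ≤ deg p → Nonzero p
  1≤deg⇒Nonzero {p} 1≤ = nonzero λ eq → ℕₚ.<-irrefl refl (subst (λ s → 1 ≤ length s ∸ 1) eq 1≤)

  infix 4 _∣_
  _∣_ : Pol → Pol → Set
  P ∣ x = Σ Pol λ z → mulL P z ≈ x

  irreducible⇒proper-factor-constant : ∀ {P s a} → Irreducible P → Nonzero a → deg a < deg P → P ≈ mulL s a → deg a ≡ 0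
  irreducible⇒proper-factor-constant {P} {s} {a} irr a≢0 a<P P≈sa =
    ℕₚ.n<1⇒n≡0 (ℕₚ.≰⇒> λ 1≤a → no-factors s a 1≤s 1≤a (≈-sym P≈sa))
    where
    open Irreducible irr
    s≢0 : Nonzero s
    s≢0 = proj₁ (mulL-nonzero⁻ s a (Nonzero-cong P≈sa (1≤deg⇒Nonzero nonconstant)))
    degP≡ : deg P ≡ deg s ℕ.+ deg a
    degP≡ = trans (deg-cong P≈sa) (deg-mulL s≢0 a≢0)
    1≤s : 1 ≤ deg s
    1≤s with deg s | degP≡
    ... | zero  | eq = ⊥-elim (ℕₚ.<-irrefl (sym eq) a<P)
    ... | suc _ | _  = s≤s z≤n

  constant-unit : ∀ {a} → Nonzero a → deg a ≡ 0 → mulL (lead a ⁻¹ ∷ []) a ≈ one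
  constant-unit {a} a≢0 deg0 = ≈-trans (mulL-constˡ (lead a ⁻¹) [] a ≈-refl) (mk≈ λ where
    zero    → trans (coeff-scaleL _ a 0) (trans (cong (lead a ⁻¹ *_) (trans (cong (coeff a) (sym deg0)) (coeff-deg a)))
                (inverseˡ (lead a) (lead≢0 a≢0)))
    (suc i) → trans (coeff-scaleL _ a (suc i))
                (trans (cong (lead a ⁻¹ *_) (coeff-above-deg a (suc i) (subst (_< suc i) (sym deg0) (s≤s z≤n)))) (zeroʳ _)))

  -- n bounds deg a and drops with each remainder.
  bezout : ∀ {P} → Irreducible P → ∀ n {a} → DegBelow a (deg P) → Nonzero a → deg a < n →
           Σ Pol λ u → Σ Pol λ v → addL (mulL u P) (mulL v a) ≈ one
  bezout {P} irr (suc n) {a} a<P a≢0 (s≤s a≤n)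
    with divide a≢0 (length P) {P} (coeff-length P)
  ... | divMod s r P≈sa+r r< with nonzero? r
  ... | inj₂ r≈[] =
    [] , lead a ⁻¹ ∷ [] ,
    constant-unit a≢0 (irreducible⇒proper-factor-constant {s = s} irr a≢0 (deg< a a<P a≢0)
      (≈-trans P≈sa+r (addL-identityʳ _ r≈[])))
  ... | inj₁ r≢0
    with bezout irr n (λ i le → r< i (ℕₚ.≤-trans (ℕₚ.<⇒≤ (deg< a a<P a≢0)) le)) r≢0
                (ℕₚ.<-≤-trans (deg< r r< r≢0) a≤n)
  ... | u , v , uP+vr≈1 = addL u v , scaleL (- 1#) (mulL v s) , (begin
    addL (mulL (addL u v) P) (mulL (scaleL (- 1#) (mulL v s)) a)
      ≈⟨ addL-cong (mulL-distribʳ u v P) (≈-trans (mulL-scaleˡ (- 1#) (mulL v s) a) (scaleL-cong (mulL-assoc v s a))) ⟩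
    addL (addL (mulL u P) (mulL v P)) (scaleL (- 1#) (mulL v (mulL s a)))
      ≈⟨ addL-assoc (mulL u P) (mulL v P) _ ⟩
    addL (mulL u P) (mulL v P − mulL v (mulL s a))
      ≈⟨ addL-cong (≈-refl {mulL u P}) (mulL-distribˡ-− v P (mulL s a)) ⟨
    addL (mulL u P) (mulL v (P − mulL s a))
      ≈⟨ addL-cong (≈-refl {mulL u P}) (mulL-cong (≈-refl {v}) (≈-+⇒−-≈ P≈sa+r)) ⟨
    addL (mulL u P) (mulL v r)
      ≈⟨ uP+vr≈1 ⟩
    one ∎)
    where open SetoidReasoning ≈-setoid

  euclid : ∀ {P} → Irreducible P → ∀ x y → P ∣ mulL x y → (P ∣ x) ⊎ (P ∣ y)
  euclid {P} irr x y (z , Pz≈xy) with divide P≢0 (length x) {x} (coeff-length x)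
    where P≢0 = 1≤deg⇒Nonzero (Irreducible.nonconstant irr)
  ... | divMod t a x≈tP+a a< with nonzero? a
  ... | inj₂ a≈[] = inj₁ (t , ≈-trans (mulL-comm P t) (≈-sym (≈-trans x≈tP+a (addL-identityʳ (mulL t P) a≈[]))))
  ... | inj₁ a≢0 with bezout irr (suc (deg a)) a< a≢0 (ℕₚ.n<1+n _)
  ... | u , v , uP+va≈1 = inj₂ (addL (mulL u y) (mulL v Z) , ≈-sym y≈)
    where
    open SetoidReasoning ≈-setoid
    Z = z − mulL t y
    ay≈PZ : mulL a y ≈ mulL P Z
    ay≈PZ = begin
      mulL a y                             ≈⟨ mulL-cong (≈-+⇒−-≈ x≈tP+a) (≈-refl {y}) ⟩
      mulL (x − mulL t P) y                ≈⟨ mulL-distribʳ-− x (mulL t P) y ⟩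
      mulL x y − mulL (mulL t P) y         ≈⟨ addL-cong (≈-sym Pz≈xy) (scaleL-cong (mulL-assoc t P y)) ⟩
      mulL P z − mulL t (mulL P y)         ≈⟨ addL-cong (≈-refl {mulL P z}) (scaleL-cong (mulL-swap t P y)) ⟩
      mulL P z − mulL P (mulL t y)         ≈⟨ mulL-distribˡ-− P z (mulL t y) ⟨
      mulL P Z                             ∎
    y≈ : y ≈ mulL P (addL (mulL u y) (mulL v Z))
    y≈ = begin
      y                                                ≈⟨ mulL-identityˡ y ⟨
      mulL one y                                       ≈⟨ mulL-cong uP+va≈1 (≈-refl {y}) ⟨
      mulL (addL (mulL u P) (mulL v a)) y              ≈⟨ mulL-distribʳ (mulL u P) (mulL v a) y ⟩
      addL (mulL (mulL u P) y) (mulL (mulL v a) y)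
        ≈⟨ addL-cong (≈-trans (mulL-assoc u P y) (mulL-swap u P y)) (mulL-assoc v a y) ⟩
      addL (mulL P (mulL u y)) (mulL v (mulL a y))
        ≈⟨ addL-cong (≈-refl {mulL P (mulL u y)}) (≈-trans (mulL-cong (≈-refl {v}) ay≈PZ) (mulL-swap v P Z)) ⟩
      addL (mulL P (mulL u y)) (mulL P (mulL v Z))     ≈⟨ mulL-distribˡ P (mulL u y) (mulL v Z) ⟨
      mulL P (addL (mulL u y) (mulL v Z))              ∎

  irreducible∣^P⇒deg≡ : ∀ {P Q} → Irreducible P → Irreducible Q → ∀ i → P ∣ Q ^P i → deg P ≡ deg Q
  irreducible∣^P⇒deg≡ {P} {Q} irrP irrQ zero (z , Pz≈1) =
    ⊥-elim (ℕₚ.1+n≰n (subst (1 ≤_) (sym 0≡)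
      (ℕₚ.≤-trans (Irreducible.nonconstant irrP) (ℕₚ.m≤m+n (deg P) (deg z)))))
    where
    nz = mulL-nonzero⁻ P z (Nonzero-cong (≈-sym Pz≈1) one-nonzero)
    0≡ : 0 ≡ deg P ℕ.+ deg z
    0≡ = trans (sym deg-one) (trans (deg-cong (≈-sym Pz≈1)) (deg-mulL (proj₁ nz) (proj₂ nz)))
  irreducible∣^P⇒deg≡ {P} {Q} irrP irrQ (suc i) (z , Pz≈Q^)
    with euclid irrP Q (Q ^P i) (z , ≈-trans Pz≈Q^ (⊗-≈ Q (Q ^P i)))
  ... | inj₂ P∣Q^i = irreducible∣^P⇒deg≡ irrP irrQ i P∣Q^i
  ... | inj₁ (w , Pw≈Q) = sym (trans (deg-cong (≈-sym Pw≈Q))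
    (trans (deg-mulL P≢0 w≢0) (trans (cong (deg P ℕ.+_) w-const) (ℕₚ.+-identityʳ (deg P)))))
    where
    Pw≢0 = mulL-nonzero⁻ P w (Nonzero-cong (≈-sym Pw≈Q) (1≤deg⇒Nonzero (Irreducible.nonconstant irrQ)))
    P≢0 = proj₁ Pw≢0
    w≢0 = proj₂ Pw≢0
    w-const : deg w ≡ 0
    w-const = ℕₚ.n<1⇒n≡0 (ℕₚ.≰⇒> λ 1≤w → Irreducible.no-factors irrQ P w (Irreducible.nonconstant irrP) 1≤w Pw≈Q)

  ^P-≈-^P⇒deg≡ : ∀ {P Q} → Irreducible P → Irreducible Q → ∀ j i → P ^P suc j ≈ Q ^P i → deg P ≡ deg Q
  ^P-≈-^P⇒deg≡ {P} irrP irrQ j i e = irreducible∣^P⇒deg≡ irrP irrQ i (P ^P j , ≈-trans (≈-sym (⊗-≈ P (P ^P j))) e)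

  ρ-irreducible : ∀ {P} → Irreducible P → MonicT∤ P → Irreducible (ρ P)
  ρ-irreducible {P} irr m = record
    { nonconstant = subst (1 ≤_) (sym (deg-ρ-monicT∤ m)) nonconstant
    ; no-factors  = no-factors′ }
    where
    open Irreducible irr
    no-factors′ : ∀ a b → 1 ≤ deg a → 1 ≤ deg b → mulL a b ≈ ρ P → ⊥
    no-factors′ a b 1≤a 1≤b ab≈ρP = no-factors (ρ a) (ρ b) 1≤ρa 1≤ρb ρaρb≈P
      where
      a≢0 = 1≤deg⇒Nonzero {a} 1≤a
      b≢0 = 1≤deg⇒Nonzero {b} 1≤b
      a₀b₀≢0 : coeff a 0 * coeff b 0 ≢ 0#
      a₀b₀≢0 eq = MonicT∤.coeff₀≢0 (ρ-monicT∤ m) (trans (sym (at ab≈ρP 0)) (trans (coeff-mulL a b 0) eq))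
      a₀≢0 : coeff a 0 ≢ 0#
      a₀≢0 eq = a₀b₀≢0 (trans (cong (λ x → x * coeff b 0) eq) (zeroˡ _))
      b₀≢0 : coeff b 0 ≢ 0#
      b₀≢0 eq = a₀b₀≢0 (trans (cong (coeff a 0 *_) eq) (zeroʳ _))
      1≤ρa = subst (1 ≤_) (sym (deg-ρ a≢0 a₀≢0)) 1≤a
      1≤ρb = subst (1 ≤_) (sym (deg-ρ b≢0 b₀≢0)) 1≤b
      ρaρb≈P : mulL (ρ a) (ρ b) ≈ P
      ρaρb≈P = ≈-trans (≈-sym (⊗-≈ (ρ a) (ρ b)))
        (≡⇒≈ (trans (sym (ρ-⊗ a≢0 b≢0)) (trans (ρ-cong (≈-trans (⊗-≈ a b) ab≈ρP)) (ρ-involutive m))))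

module Enumeration (F : FiniteField) where
  open FiniteField F
    renaming (_+_ to infixl 6 _+_; _*_ to infixl 7 _*_; -_ to infix 8 -_; _⁻¹ to infix 9 _⁻¹)
  open Poly F renaming (_⊖_ to infixl 6 _⊖_; _⊗_ to infixl 7 _⊗_; _^P_ to infixr 8 _^P_;
                        _* to infix 10 _*; _==_ to infix 4 _==_)
  open FieldFacts F
  open Coefficients F
  open Arithmetic F
  open Lists F

  ∈-vecs⁻ : ∀ m {v} → v ∈ vecs m → length v ≡ m
  ∈-vecs⁻ zero    (here refl) = refl
  ∈-vecs⁻ (suc m) v∈ with ∈-concatMap⁻′ (λ a → map (a ∷_) (vecs m)) elements v∈
  ... | a , _ , v∈a with ∈-map⁻ (a ∷_) v∈a
  ...   | w , w∈ , refl = cong suc (∈-vecs⁻ m w∈)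

  ∈-vecs⁺ : ∀ v → v ∈ vecs (length v)
  ∈-vecs⁺ []      = here refl
  ∈-vecs⁺ (a ∷ v) =
    ∈-concatMap⁺′ (λ a → map (a ∷_) (vecs (length v))) elements (complete a) (∈-map⁺ (a ∷_) (∈-vecs⁺ v))

  vecs-unique : ∀ m → Unique (vecs m)
  vecs-unique zero    = All.[] ∷ []
  vecs-unique (suc m) = concatMap-unique (λ a → map (a ∷_) (vecs m)) unique
    (λ a → Uniqueₚ.map⁺ Listₚ.∷-injectiveʳ (vecs-unique m)) (coeff-at 0) tag≡
    where
    coeff-at : ℕ → Pol → Carrier
    coeff-at i p = coeff p i
    tag≡ : ∀ a {v} → v ∈ map (a ∷_) (vecs m) → coeff v 0 ≡ a
    tag≡ a v∈ with ∈-map⁻ (a ∷_) v∈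
    ... | _ , _ , refl = refl

  ∈-monicUpTo⁻ : ∀ d {f} → f ∈ monicUpTo d → Normal f × lead f ≡ 1# × deg f ≤ d
  ∈-monicUpTo⁻ d f∈ with ∈-concatMap⁻′ monicDeg (upTo (suc d)) f∈
  ... | k , k∈ , f∈k with ∈-map⁻ (_∷ʳ 1#) f∈k
  ...   | v , v∈ , refl = ∷ʳ-normal v 1≢0 , lead-∷ʳ v 1≢0 ,
    subst (_≤ d) (sym (trans (deg-∷ʳ v 1≢0) (∈-vecs⁻ k v∈))) (ℕₚ.≤-pred (∈-upTo⁻ k∈))

  ∈-monicUpTo⁺ : ∀ d {f} → Normal f → lead f ≡ 1# → deg f ≤ d → f ∈ monicUpTo d
  ∈-monicUpTo⁺ d {f} f-normal lead≡1 f≤d with normal-∷ʳ f-normal (lead≡1⇒Nonzero lead≡1)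
  ... | v , f≡ , len≡ = subst (_∈ monicUpTo d) (sym (trans f≡ (cong (v ∷ʳ_) lead≡1)))
    (∈-concatMap⁺′ monicDeg (upTo (suc d)) (∈-upTo⁺ (s≤s (subst (_≤ d) (sym len≡) f≤d)))
      (∈-map⁺ (_∷ʳ 1#) (∈-vecs⁺ v)))

  monicUpTo-unique : ∀ d → Unique (monicUpTo d)
  monicUpTo-unique d = concatMap-unique monicDeg (Uniqueₚ.upTo⁺ (suc d))
    (λ k → Uniqueₚ.map⁺ (λ {v} {w} eq → proj₁ (Listₚ.∷ʳ-injective v w eq)) (vecs-unique k))
    (λ f → length f ∸ 1) tag≡
    where
    tag≡ : ∀ k {f} → f ∈ monicDeg k → length f ∸ 1 ≡ k
    tag≡ k f∈ with ∈-map⁻ (_∷ʳ 1#) f∈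
    ... | v , v∈ , refl = trans (length-∷ʳ∸1 v 1#) (∈-vecs⁻ k v∈)

  T-not-isZ⁻ : ∀ {c} → T (not (isZ c)) → c ≢ 0#
  T-not-isZ⁻ {c} t with c ≟ 0#
  ... | no c≢0 = c≢0

  T-not-isZ⁺ : ∀ {c} → c ≢ 0# → T (not (isZ c))
  T-not-isZ⁺ {c} c≢0 with c ≟ 0#
  ... | yes c≡0 = c≢0 c≡0
  ... | no  _   = tt

  private
    units : List Carrier
    units = filterᵇ (λ c → not (isZ c)) elements

    ∈-units⁻ : ∀ {c} → c ∈ units → c ≢ 0#
    ∈-units⁻ c∈ = T-not-isZ⁻ (proj₂ (∈-filterᵇ⁻ (λ c → not (isZ c)) {elements} c∈))

    ∈-units⁺ : ∀ {c} → c ≢ 0# → c ∈ units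
    ∈-units⁺ {c} c≢0 = ∈-filterᵇ⁺ (λ c → not (isZ c)) (complete c) (T-not-isZ⁺ c≢0)

    withTop : Pol → List Pol
    withTop v = map (v ∷ʳ_) units

  ∈-polysDeg⁻ : ∀ n {f} → f ∈ polysDeg n → Normal f × Nonzero f × deg f ≡ n
  ∈-polysDeg⁻ n f∈ with ∈-concatMap⁻′ withTop (vecs n) f∈
  ... | v , v∈ , f∈v with ∈-map⁻ (v ∷ʳ_) f∈v
  ...   | c , c∈ , refl = ∷ʳ-normal v c≢0 , ∷ʳ-nonzero v c≢0 , trans (deg-∷ʳ v c≢0) (∈-vecs⁻ n v∈)
    where c≢0 = ∈-units⁻ c∈

  ∈-polysDeg⁺ : ∀ n {f} → Normal f → Nonzero f → deg f ≡ n → f ∈ polysDeg n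
  ∈-polysDeg⁺ n {f} f-normal f≢0 deg≡n with normal-∷ʳ f-normal f≢0
  ... | v , f≡ , len≡ = subst (_∈ polysDeg n) (sym f≡)
    (∈-concatMap⁺′ withTop (vecs n) (subst (λ k → v ∈ vecs k) (trans len≡ deg≡n) (∈-vecs⁺ v))
      (∈-map⁺ (v ∷ʳ_) (∈-units⁺ (lead≢0 f≢0))))

  polysDeg-unique : ∀ n → Unique (polysDeg n)
  polysDeg-unique n = concatMap-unique withTop (vecs-unique n)
    (λ v → Uniqueₚ.map⁺ (λ {a} {b} eq → proj₂ (Listₚ.∷ʳ-injective v v eq))
                        (filterᵇ-unique (λ c → not (isZ c)) unique))
    (λ f → List.take (length f ∸ 1) f) tag≡
    where
    tag≡ : ∀ v {f} → f ∈ withTop v → List.take (length f ∸ 1) f ≡ v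
    tag≡ v f∈ with ∈-map⁻ (v ∷ʳ_) f∈
    ... | c , _ , refl = trans (cong (λ k → List.take k (v ∷ʳ c)) (length-∷ʳ∸1 v c)) (take-∷ʳ v)
      where
      take-∷ʳ : ∀ v → List.take (length v) (v ∷ʳ c) ≡ v
      take-∷ʳ []      = refl
      take-∷ʳ (a ∷ v) = cong (a ∷_) (take-∷ʳ v)

  ∈-polysUpTo⁺ : ∀ d {f} → Normal f → deg f ≤ d → f ∈ polysUpTo d
  ∈-polysUpTo⁺ d {f} f-normal f≤d with nonzero? f
  ... | inj₂ f≈[] = here (trans (sym f-normal) (strip-cong f≈[]))
  ... | inj₁ f≢0  =
    there (∈-concatMap⁺′ polysDeg (upTo (suc d)) (∈-upTo⁺ (s≤s f≤d)) (∈-polysDeg⁺ (deg f) f-normal f≢0 refl))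

module Predicates (F : FiniteField) where
  open FiniteField F
    renaming (_+_ to infixl 6 _+_; _*_ to infixl 7 _*_; -_ to infix 8 -_; _⁻¹ to infix 9 _⁻¹)
  open Poly F renaming (_⊖_ to infixl 6 _⊖_; _⊗_ to infixl 7 _⊗_; _^P_ to infixr 8 _^P_;
                        _* to infix 10 _*; _==_ to infix 4 _==_)
  open Coefficients F
  open Arithmetic F
  open Divisibility F
  open Lists F
  open Enumeration F

  T-nonconst⁻ : ∀ p → T (nonconst p) → 1 ≤ deg p
  T-nonconst⁻ p = ℕₚ.≤ᵇ⇒≤ 1 (deg p)

  T-nonconst⁺ : ∀ p → 1 ≤ deg p → T (nonconst p)
  T-nonconst⁺ p = ℕₚ.≤⇒≤ᵇ

  private
    Factorization? : Pol → Pol → Pol → Bool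
    Factorization? P a b = nonconst a ∧ nonconst b ∧ (a ⊗ b == P)

  irreducible-sound : ∀ P → T (irreducible P) → Irreducible P
  irreducible-sound P t = record { nonconstant = T-nonconst⁻ P nc ; no-factors = no-factors }
    where
    nc×none = Equivalence.to T-∧ t
    nc = proj₁ nc×none
    no-factors : ∀ a b → 1 ≤ deg a → 1 ≤ deg b → mulL a b ≈ P → ⊥
    no-factors a b 1≤a 1≤b ab≈P = subst T (Equivalence.to T-not-≡ (proj₂ nc×none)) found
      where
      degP≡ : deg P ≡ deg a ℕ.+ deg b
      degP≡ = trans (sym (deg-cong ab≈P)) (deg-mulL (1≤deg⇒Nonzero {a} 1≤a) (1≤deg⇒Nonzero {b} 1≤b))
      candidate : ∀ c → deg c ≤ deg P → strip c ∈ polysUpTo (deg P)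
      candidate c c≤P = ∈-polysUpTo⁺ (deg P) (strip-normal c) (subst (_≤ deg P) (sym (deg-cong (strip-≈ c))) c≤P)
      found : T (anyᵇ (λ a → anyᵇ (Factorization? P a) (polysUpTo (deg P))) (polysUpTo (deg P)))
      found = anyᵇ-complete _ (candidate a (subst (deg a ≤_) (sym degP≡) (ℕₚ.m≤m+n _ _)))
        (anyᵇ-complete _ (candidate b (subst (deg b ≤_) (sym degP≡) (ℕₚ.m≤n+m _ _)))
          (Equivalence.from T-∧ (T-nonconst⁺ (strip a) (subst (1 ≤_) (sym (deg-cong (strip-≈ a))) 1≤a) ,
           Equivalence.from T-∧ (T-nonconst⁺ (strip b) (subst (1 ≤_) (sym (deg-cong (strip-≈ b))) 1≤b) ,
             ==-complete (≈-trans (⊗-cong (strip-≈ a) (strip-≈ b)) (≈-trans (⊗-≈ a b) ab≈P))))))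

  irreducible-complete : ∀ P → Irreducible P → T (irreducible P)
  irreducible-complete P irr =
    Equivalence.from T-∧ (T-nonconst⁺ P nonconstant , Equivalence.from T-not-≡ (¬T⇒≡false no-factorization))
    where
    open Irreducible irr
    ¬T⇒≡false : ∀ {b} → ¬ T b → b ≡ false
    ¬T⇒≡false {true}  ¬t = ⊥-elim (¬t tt)
    ¬T⇒≡false {false} _  = refl
    no-factorization : ¬ T (anyᵇ (λ a → anyᵇ (Factorization? P a) (polysUpTo (deg P))) (polysUpTo (deg P)))
    no-factorization t with anyᵇ-sound _ (polysUpTo (deg P)) t
    ... | a , _ , t′ with anyᵇ-sound _ (polysUpTo (deg P)) t′
    ... | b , _ , t″ with Equivalence.to T-∧ t″
    ... | nc-a , rest with Equivalence.to T-∧ rest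
    ... | nc-b , ab==P = no-factors a b (T-nonconst⁻ a nc-a) (T-nonconst⁻ b nc-b)
      (≈-trans (≈-sym (⊗-≈ a b)) (==-sound (a ⊗ b) P ab==P))

  divides-T^-sound : ∀ M D → T (divides (T^ M) D) → ∀ i → i < M → coeff D i ≡ 0#
  divides-T^-sound M D t i i<M with anyᵇ-sound (λ c → T^ M ⊗ c == D) (polysUpTo (deg D)) t
  ... | c , _ , T^c==D = begin
    coeff D i                        ≡⟨ at (==-sound (T^ M ⊗ c) D T^c==D) i ⟨
    coeff (T^ M ⊗ c) i               ≡⟨ at (≈-trans (⊗-≈ (T^ M) c) (mulL-T^ M c)) i ⟩
    coeff (replicate M 0# ++ c) i    ≡⟨ coeff-shift-lo M c i i<M ⟩
    0#                               ∎
    where open ≡-Reasoning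

  divides-T^-complete : ∀ M D → (∀ i → i < M → coeff D i ≡ 0#) → T (divides (T^ M) D)
  divides-T^-complete M D low≡0 = anyᵇ-complete (λ c → T^ M ⊗ c == D) c∈ (==-complete T^c≈D)
    where
    c = strip (List.drop M D)
    coeff-c : ∀ j → coeff c j ≡ coeff D (M ℕ.+ j)
    coeff-c j = trans (coeff-strip (List.drop M D) j) (coeff-drop M D j)
      where
      coeff-drop : ∀ M (D : Pol) j → coeff (List.drop M D) j ≡ coeff D (M ℕ.+ j)
      coeff-drop zero    D       j = refl
      coeff-drop (suc M) []      j = refl
      coeff-drop (suc M) (x ∷ D) j = coeff-drop M D j
    T^c≈D : T^ M ⊗ c ≈ D
    T^c≈D = ≈-trans (⊗-≈ (T^ M) c) (≈-trans (mulL-T^ M c) (mk≈ shifted))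
      where
      shifted : ∀ i → coeff (replicate M 0# ++ c) i ≡ coeff D i
      shifted i with ℕₚ.<-≤-connex i M
      ... | inj₁ i<M = trans (coeff-shift-lo M c i i<M) (sym (low≡0 i i<M))
      ... | inj₂ M≤i = trans (coeff-shift-≥ M c M≤i) (trans (coeff-c (i ∸ M)) (cong (coeff D) (ℕₚ.m+[n∸m]≡n M≤i)))
    c∈ : c ∈ polysUpTo (deg D)
    c∈ = ∈-polysUpTo⁺ (deg D) (strip-normal (List.drop M D)) (deg≤ c λ j lt →
      trans (coeff-c j) (coeff-above-deg D (M ℕ.+ j) (ℕₚ.<-≤-trans lt (ℕₚ.m≤n+m j M))))

  2≤q : 2 ≤ q
  2≤q = two-distinct elements unique (complete 0#) (complete 1#) 0≢1
    where
    two-distinct : ∀ (L : List Carrier) → Unique L → ∀ {a b} → a ∈ L → b ∈ L → a ≢ b → 2 ≤ length L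
    two-distinct (x ∷ L) _        (here refl) (here refl) a≢b = ⊥-elim (a≢b refl)
    two-distinct (x ∷ L) _        (here refl) (there b∈)  _   = s≤s (∈-length b∈)
    two-distinct (x ∷ L) _        (there a∈)  (here refl) _   = s≤s (∈-length a∈)
    two-distinct (x ∷ L) (_ ∷ L!) (there a∈)  (there b∈)  a≢b = ℕₚ.m≤n⇒m≤1+n (two-distinct L L! a∈ b∈ a≢b)

  instance
    q≢0 : ℕ.NonZero q
    q≢0 = ℕ.>-nonZero (ℕₚ.<-trans (s≤s z≤n) 2≤q)

  ^-cancelʳ-≤ : ∀ d e → q ℕ.^ d ≤ q ℕ.^ e → d ≤ e
  ^-cancelʳ-≤ d e le with ℕₚ.≤-<-connex d e
  ... | inj₁ d≤e = d≤e
  ... | inj₂ e<d = ⊥-elim (ℕₚ.<⇒≱ (ℕₚ.^-monoʳ-< q 2≤q e<d) le)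

  ∣∣≤ᵇ-sound : ∀ g e → T (∣ g ∣ ≤ᵇ q ℕ.^ e) → DegAtMost g e
  ∣∣≤ᵇ-sound g e t i e<i with strip g in strip≡
  ... | []    = trans (sym (coeff-strip g i)) (cong (λ s → coeff s i) strip≡)
  ... | _ ∷ _ = coeff-above-deg g i (ℕₚ.≤-<-trans (^-cancelʳ-≤ (deg g) e (ℕₚ.≤ᵇ⇒≤ _ _ t)) e<i)

  ∣∣≤ᵇ-complete : ∀ g e → DegAtMost g e → T (∣ g ∣ ≤ᵇ q ℕ.^ e)
  ∣∣≤ᵇ-complete g e g≤e with strip g
  ... | []    = tt
  ... | _ ∷ _ = ℕₚ.≤⇒≤ᵇ (ℕₚ.^-monoʳ-≤ q (deg≤ g g≤e))

  at0≡coeff₀ : ∀ p → at0 p ≡ coeff p 0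
  at0≡coeff₀ p with strip p | coeff-strip p 0
  ... | []    | eq = eq
  ... | _ ∷ _ | eq = eq

module VonMangoldt (F : FiniteField) where
  open FiniteField F
    renaming (_+_ to infixl 6 _+_; _*_ to infixl 7 _*_; -_ to infix 8 -_; _⁻¹ to infix 9 _⁻¹)
  open Poly F renaming (_⊖_ to infixl 6 _⊖_; _⊗_ to infixl 7 _⊗_; _^P_ to infixr 8 _^P_;
                        _* to infix 10 _*; _==_ to infix 4 _==_)
  open Coefficients F
  open Arithmetic F
  open Reciprocal F
  open Divisibility F
  open Lists F
  open Enumeration F
  open Predicates F

  PrimePower? : Pol → Pol × ℕ → Bool
  PrimePower? f (P , j) = irreducible P ∧ (P ^P j == f)

  candidates : Pol → List (Pol × ℕ)
  candidates f = concatMap (λ P → map (λ j → (P , suc j)) (upTo (deg f))) (monicUpTo (deg f))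

  witnesses : Pol → List (Pol × ℕ)
  witnesses f = filterᵇ (PrimePower? f) (candidates f)

  degOfFirst : List (Pol × ℕ) → ℕ
  degOfFirst []            = 0
  degOfFirst ((P , _) ∷ _) = deg P

  private
    filterᵇ-elim : ∀ {A : Set} (p : A → Bool) {M : List A → Set} {Q : A → List A → Bool → Set} →
      M [] → (∀ x xs → M xs → Q x xs true) → (∀ x xs → M xs → Q x xs false) →
      (∀ x xs → Q x xs (p x) → M (x ∷ xs)) →
      (∀ xs → M xs) × (∀ x xs b → M xs → Q x xs b)
    filterᵇ-elim p {M} {Q} base if-true if-false glue = ind , step
      where
      step : ∀ x xs b → M xs → Q x xs b
      step x xs true  = if-true x xs
      step x xs false = if-false x xs
      ind : ∀ xs → M xs
      ind []       = base
      ind (x ∷ xs) = glue x xs (step x xs (p x) (ind xs))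

  -- Λ is defined by a `with` on a filter whose predicate is an anonymous pattern lambda, so its
  -- with-function is reached only by abstracting the filtered list `candidates f`. The motives of
  -- filterᵇ-elim are left to unification; abstracting the literal `true` too makes them patterns.
  Λ≡degOfFirst : ∀ f → Λ f ≡ degOfFirst (witnesses f)
  Λ≡degOfFirst f
    with filterᵇ-elim (PrimePower? f) {M = _} {Q = _} refl (λ _ _ _ → refl) (λ _ _ ih → ih) (λ _ _ q → q)
       | candidates f | true
  ... | ind , _    | L             | true  = ind L
  ... | _          | []            | false = refl
  ... | ind , step | (P , j) ∷ L   | false with irreducible P ∧ (P ^P j == f)
  ...   | b = step (P , j) L b (ind L)

  record PrimePower (f P : Pol) (j : ℕ) : Set where
    field
      irreducible′ : Irreducible P
      normal       : Normal P
      lead≡1       : lead P ≡ 1#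
      1≤j          : 1 ≤ j
      P^j≈f        : P ^P j ≈ f

  ∈-witnesses⁻ : ∀ f {P j} → (P , j) ∈ witnesses f → PrimePower f P j
  ∈-witnesses⁻ f {P} {j} Pj∈ with ∈-filterᵇ⁻ (PrimePower? f) {candidates f} Pj∈
  ... | Pj∈c , t with ∈-concatMap⁻′ (λ P → map (λ j → (P , suc j)) (upTo (deg f))) (monicUpTo (deg f)) Pj∈c
  ... | P′ , P′∈ , Pj∈P′ with ∈-map⁻ (λ j → (P′ , suc j)) Pj∈P′
  ... | j′ , _ , refl with Equivalence.to T-∧ t | ∈-monicUpTo⁻ (deg f) P′∈
  ... | irr , P^j==f | P-normal , lead≡1 , _ = record
    { irreducible′ = irreducible-sound P′ irr ; normal = P-normal ; lead≡1 = lead≡1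
    ; 1≤j = s≤s z≤n ; P^j≈f = ==-sound (P′ ^P suc j′) f P^j==f }

  ∈-witnesses⁺ : ∀ f {P j} → PrimePower f P j → (P , j) ∈ witnesses f
  ∈-witnesses⁺ f {P} {zero}   pp with () ← PrimePower.1≤j pp
  ∈-witnesses⁺ f {P} {suc j′} pp = ∈-filterᵇ⁺ (PrimePower? f)
    (∈-concatMap⁺′ (λ P → map (λ j → (P , suc j)) (upTo (deg f))) (monicUpTo (deg f))
      (∈-monicUpTo⁺ (deg f) normal lead≡1 P≤f) (∈-map⁺ (λ j → (P , suc j)) (∈-upTo⁺ j′<f)))
    (Equivalence.from T-∧ (irreducible-complete P irreducible′ , ==-complete P^j≈f))
    where
    open PrimePower pp
    1≤P = Irreducible.nonconstant irreducible′
    f≡ : deg f ≡ suc j′ ℕ.* deg P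
    f≡ = trans (sym (deg-cong P^j≈f)) (deg-^P (1≤deg⇒Nonzero {P} 1≤P) (suc j′))
    P≤f : deg P ≤ deg f
    P≤f = subst (deg P ≤_) (sym f≡) (ℕₚ.m≤m+n (deg P) _)
    j′<f : j′ < deg f
    j′<f = subst (j′ <_) (sym f≡)
      (ℕₚ.<-≤-trans (ℕₚ.n<1+n j′) (ℕₚ.m≤m*n (suc j′) (deg P) {{ℕ.>-nonZero 1≤P}}))

  PrimePower-deg : ∀ {f P Q j i} → PrimePower f P j → PrimePower f Q i → deg P ≡ deg Q
  PrimePower-deg {j = zero}   pp _  with () ← PrimePower.1≤j pp
  PrimePower-deg {j = suc j′} {i} pp pq =
    ^P-≈-^P⇒deg≡ (PrimePower.irreducible′ pp) (PrimePower.irreducible′ pq) j′ i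
      (≈-trans (PrimePower.P^j≈f pp) (≈-sym (PrimePower.P^j≈f pq)))

  primePower? : ∀ f → (∃[ P ] ∃[ j ] PrimePower f P j) ⊎ (∀ {P j} → ¬ PrimePower f P j)
  primePower? f with witnesses f | ∈-witnesses⁻ f | ∈-witnesses⁺ f
  ... | []          | _     | complete = inj₂ λ pp → case (complete pp)
    where
    case : ∀ {x : Pol × ℕ} → x ∈ [] → ⊥
    case ()
  ... | (P , j) ∷ _ | sound | _        = inj₁ (P , j , sound (here refl))

  Λ-PrimePower : ∀ {f P j} → PrimePower f P j → Λ f ≡ deg P
  Λ-PrimePower {f} {P} {j} pp = trans (Λ≡degOfFirst f) (first (witnesses f) (∈-witnesses⁻ f) (∈-witnesses⁺ f pp))
    where
    first : ∀ l → (∀ {Q i} → (Q , i) ∈ l → PrimePower f Q i) → (P , j) ∈ l → degOfFirst l ≡ deg P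
    first ((Q , i) ∷ _) sound _ = PrimePower-deg (sound (here refl)) pp

  Λ-¬PrimePower : ∀ {f} → (∀ {P j} → ¬ PrimePower f P j) → Λ f ≡ 0
  Λ-¬PrimePower {f} none = trans (Λ≡degOfFirst f) (empty (witnesses f) (∈-witnesses⁻ f))
    where
    empty : ∀ l → (∀ {Q i} → (Q , i) ∈ l → PrimePower f Q i) → degOfFirst l ≡ 0
    empty []            _     = refl
    empty ((Q , i) ∷ _) sound = ⊥-elim (none (sound (here refl)))

  ρ-PrimePower : ∀ {x P j} → MonicT∤ x → PrimePower x P j → PrimePower (ρ x) (ρ P) j × deg (ρ P) ≡ deg P
  ρ-PrimePower {j = zero}   _ pp with () ← PrimePower.1≤j pp
  ρ-PrimePower {x} {P} {suc j′} m pp = record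
    { irreducible′ = ρ-irreducible irreducible′ P-monicT∤
    ; normal       = MonicT∤.normal (ρ-monicT∤ P-monicT∤)
    ; lead≡1       = MonicT∤.lead≡1 (ρ-monicT∤ P-monicT∤)
    ; 1≤j          = 1≤j
    ; P^j≈f        = ≡⇒≈ (trans (sym (ρ-^P P≢0 (suc j′))) (ρ-cong P^j≈f)) }
    , deg-ρ-monicT∤ P-monicT∤
    where
    open PrimePower pp
    P₀≢0 : coeff P 0 ≢ 0#
    P₀≢0 = coeff₀-^P≢0 P j′ λ eq → MonicT∤.coeff₀≢0 m (trans (sym (at P^j≈f 0)) eq)
    P-monicT∤ : MonicT∤ P
    P-monicT∤ = record { normal = normal ; lead≡1 = lead≡1 ; coeff₀≢0 = P₀≢0 }
    P≢0 = MonicT∤.nonzero′ P-monicT∤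

  Λ-ρ : ∀ {x} → MonicT∤ x → Λ (ρ x) ≡ Λ x
  Λ-ρ {x} m with primePower? x
  ... | inj₁ (P , j , pp) = trans (Λ-PrimePower (proj₁ ρpp)) (trans (proj₂ ρpp) (sym (Λ-PrimePower pp)))
    where ρpp = ρ-PrimePower m pp
  ... | inj₂ none = trans (Λ-¬PrimePower none′) (sym (Λ-¬PrimePower none))
    where
    none′ : ∀ {Q i} → ¬ PrimePower (ρ x) Q i
    none′ pp = none (subst (λ y → PrimePower y _ _) (ρ-involutive m) (proj₁ (ρ-PrimePower (ρ-monicT∤ m) pp)))

  factorizations : ℕ → Pol → List (List Pol)
  factorizations k g = filterᵇ (λ fs → prodP fs == g) (tuples k (monicUpTo (deg g)))

  record Factorization (k : ℕ) (g : Pol) (fs : List Pol) : Set where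
    field
      factors-monicT∤ : All MonicT∤ fs
      factors≤        : All (λ f → deg f ≤ deg g) fs
      length≡         : length fs ≡ k
      prodP≈          : prodP fs ≈ g

  ∈-factorizations⁻ : ∀ k {g fs} → MonicT∤ g → fs ∈ factorizations k g → Factorization k g fs
  ∈-factorizations⁻ k {g} {fs} m fs∈ with ∈-filterᵇ⁻ (λ fs → prodP fs == g) {tuples k (monicUpTo (deg g))} fs∈
  ... | fs∈t , t with ∈-tuples⁻ k (monicUpTo (deg g)) fs∈t
  ... | length≡ , fs⊆ = record
    { factors-monicT∤ =
        All.zipWith (λ (f∈ , f₀≢0) → monicT∤ f∈ f₀≢0) (All.tabulate fs⊆ , coeff₀-prodP≢0 fs prod₀≢0)
    ; factors≤        = All.map (λ f∈ → proj₂ (proj₂ (∈-monicUpTo⁻ (deg g) f∈))) (All.tabulate fs⊆)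
    ; length≡         = length≡
    ; prodP≈          = prodP≈ }
    where
    prodP≈ = ==-sound (prodP fs) g t
    prod₀≢0 : coeff (prodP fs) 0 ≢ 0#
    prod₀≢0 eq = MonicT∤.coeff₀≢0 m (trans (sym (at prodP≈ 0)) eq)
    monicT∤ : ∀ {f} → f ∈ monicUpTo (deg g) → coeff f 0 ≢ 0# → MonicT∤ f
    monicT∤ f∈ f₀≢0 with ∈-monicUpTo⁻ (deg g) f∈
    ... | f-normal , lead≡1 , _ = record { normal = f-normal ; lead≡1 = lead≡1 ; coeff₀≢0 = f₀≢0 }

  ρ-factorization : ∀ k {g fs} → MonicT∤ g → fs ∈ factorizations k g → map ρ fs ∈ factorizations k (ρ g)
  ρ-factorization k {g} {fs} m fs∈ = ∈-filterᵇ⁺ (λ fs → prodP fs == ρ g)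
    (∈-tuples⁺ k (monicUpTo (deg (ρ g))) (trans (Listₚ.length-map ρ fs) length≡) ρfs⊆)
    (==-complete (≡⇒≈ (trans (sym (ρ-prodP (All.map MonicT∤.nonzero′ factors-monicT∤))) (ρ-cong prodP≈))))
    where
    open Factorization (∈-factorizations⁻ k m fs∈)
    ρfs⊆ : map ρ fs ⊆ monicUpTo (deg (ρ g))
    ρfs⊆ y∈ with ∈-map⁻ ρ y∈
    ... | f , f∈ , refl = ∈-monicUpTo⁺ (deg (ρ g)) (MonicT∤.normal ρm) (MonicT∤.lead≡1 ρm)
      (subst₂ _≤_ (sym (deg-ρ-monicT∤ fm)) (sym (deg-ρ-monicT∤ m)) (All.lookup factors≤ f∈))
      where
      fm = All.lookup factors-monicT∤ f∈
      ρm = ρ-monicT∤ fm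

  map-ρ-involutive : ∀ {fs} → All MonicT∤ fs → map ρ (map ρ fs) ≡ fs
  map-ρ-involutive []       = refl
  map-ρ-involutive (m ∷ ms) = cong₂ _∷_ (ρ-involutive m) (map-ρ-involutive ms)

  prodℕ-Λ-ρ : ∀ {fs} → All MonicT∤ fs → prodℕ (map Λ (map ρ fs)) ≡ prodℕ (map Λ fs)
  prodℕ-Λ-ρ []       = refl
  prodℕ-Λ-ρ (m ∷ ms) = cong₂ ℕ._*_ (Λ-ρ m) (prodℕ-Λ-ρ ms)

  factorizations-unique : ∀ k g → Unique (factorizations k g)
  factorizations-unique k g = filterᵇ-unique _ (tuples-unique k (monicUpTo-unique (deg g)))

  Λmon-ρ : ∀ k {g} → MonicT∤ g → Λmon k (ρ g) ≡ Λmon k g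
  Λmon-ρ k {g} m = sym (sumℕ-bijection weight weight (map ρ) (map ρ)
    (factorizations-unique k g) (factorizations-unique k (ρ g))
    (ρ-factorization k m)
    (λ fs∈ → subst (λ h → map ρ _ ∈ factorizations k h) (ρ-involutive m) (ρ-factorization k (ρ-monicT∤ m) fs∈))
    (λ fs∈ → map-ρ-involutive (Factorization.factors-monicT∤ (∈-factorizations⁻ k m fs∈)))
    (λ fs∈ → map-ρ-involutive (Factorization.factors-monicT∤ (∈-factorizations⁻ k (ρ-monicT∤ m) fs∈)))
    (λ fs∈ → prodℕ-Λ-ρ (Factorization.factors-monicT∤ (∈-factorizations⁻ k m fs∈))))
    where
    weight : List Pol → ℕ
    weight fs = prodℕ (map Λ fs)

module ShortIntervals (F : FiniteField) where
  open FiniteField F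
    renaming (_+_ to infixl 6 _+_; _*_ to infixl 7 _*_; -_ to infix 8 -_; _⁻¹ to infix 9 _⁻¹)
  open Poly F renaming (_⊖_ to infixl 6 _⊖_; _⊗_ to infixl 7 _⊗_; _^P_ to infixr 8 _^P_;
                        _* to infix 10 _*; _==_ to infix 4 _==_)
  open FieldFacts F
  open Coefficients F
  open Arithmetic F
  open Reciprocal F
  open Lists F
  open Enumeration F
  open Predicates F
  open VonMangoldt F

  module _ (h m : ℕ) {B : Pol} (lead-B : lead B ≡ 1#) (deg-B : deg B ≡ m) where
    N = (h ℕ.+ 1) ℕ.+ m
    A = T^ (h ℕ.+ 1) ⊗ B

    B≢0 : Nonzero B
    B≢0 = lead≡1⇒Nonzero lead-B

    deg-A : deg A ≡ N
    deg-A = trans (deg-⊗ (T^-nonzero (h ℕ.+ 1)) B≢0)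
                  (cong₂ ℕ._+_ (deg-T^ (h ℕ.+ 1)) deg-B)

    coeff-A-high : ∀ j → coeff A ((h ℕ.+ 1) ℕ.+ j) ≡ coeff B j
    coeff-A-high j = trans (at (≈-trans (⊗-≈ (T^ (h ℕ.+ 1)) B) (mulL-T^ (h ℕ.+ 1) B)) _) (coeff-shift-hi (h ℕ.+ 1) B j)

    coeff-B* : ∀ {i} → i ≤ m → coeff (B *) i ≡ coeff B (m ∸ i)
    coeff-B* {i} i≤m = trans (coeff-*-≤ B (subst (i ≤_) (sym deg-B) i≤m)) (cong (λ d → coeff B (d ∸ i)) deg-B)

    -- |f - A| ≤ q^h
    Close : Pol → Set
    Close f = ∀ j → coeff f ((h ℕ.+ 1) ℕ.+ j) ≡ coeff B j

    -- f ≡ B* (mod T^(m+1))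
    Congruent : Pol → Set
    Congruent g = ∀ i → i ≤ m → coeff g i ≡ coeff (B *) i

    h<shift : ∀ j → h < (h ℕ.+ 1) ℕ.+ j
    h<shift j = ℕₚ.≤-trans (ℕₚ.≤-reflexive (ℕₚ.+-comm 1 h)) (ℕₚ.m≤m+n (h ℕ.+ 1) j)

    close-sound : ∀ f → T (∣ f ⊖ A ∣ ≤ᵇ q ℕ.^ h) → Close f
    close-sound f t j = trans (coeff-⊖≡0 f A _ (∣∣≤ᵇ-sound (f ⊖ A) h t _ (h<shift j))) (coeff-A-high j)

    close-complete : ∀ f → Close f → T (∣ f ⊖ A ∣ ≤ᵇ q ℕ.^ h)
    close-complete f close = ∣∣≤ᵇ-complete (f ⊖ A) h λ i h<i → coeff-≡⇒⊖≡0 f A i (agree i h<i)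
      where
      agree : ∀ i → h < i → coeff f i ≡ coeff A i
      agree i h<i = begin
        coeff f i                                   ≡⟨ cong (coeff f) i≡ ⟨
        coeff f ((h ℕ.+ 1) ℕ.+ (i ∸ (h ℕ.+ 1)))     ≡⟨ close _ ⟩
        coeff B (i ∸ (h ℕ.+ 1))                     ≡⟨ coeff-A-high _ ⟨
        coeff A ((h ℕ.+ 1) ℕ.+ (i ∸ (h ℕ.+ 1)))     ≡⟨ cong (coeff A) i≡ ⟩
        coeff A i                                   ∎
        where
        open ≡-Reasoning
        i≡ : (h ℕ.+ 1) ℕ.+ (i ∸ (h ℕ.+ 1)) ≡ i
        i≡ = ℕₚ.m+[n∸m]≡n (subst (_≤ i) (ℕₚ.+-comm 1 h) h<i)

    congruent-sound : ∀ g → T (congruent g (B *) (T^ (suc m))) → Congruent g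
    congruent-sound g t i i≤m = coeff-⊖≡0 g (B *) i (divides-T^-sound (suc m) (g ⊖ B *) t i (s≤s i≤m))

    congruent-complete : ∀ g → Congruent g → T (congruent g (B *) (T^ (suc m)))
    congruent-complete g c = divides-T^-complete (suc m) (g ⊖ B *) λ { i (s≤s i≤m) → coeff-≡⇒⊖≡0 g (B *) i (c i i≤m) }

    reverse-close : ∀ f → deg f ≡ N → Close f → Congruent (f *)
    reverse-close f deg≡N close i i≤m = begin
      coeff (f *) i
        ≡⟨ coeff-*-≤ f (subst (i ≤_) (sym deg≡N) (ℕₚ.≤-trans i≤m (ℕₚ.m≤n+m m (h ℕ.+ 1)))) ⟩
      coeff f (deg f ∸ i)                 ≡⟨ cong (λ d → coeff f (d ∸ i)) deg≡N ⟩
      coeff f (N ∸ i)                     ≡⟨ cong (coeff f) (ℕₚ.+-∸-assoc (h ℕ.+ 1) i≤m) ⟩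
      coeff f ((h ℕ.+ 1) ℕ.+ (m ∸ i))     ≡⟨ close (m ∸ i) ⟩
      coeff B (m ∸ i)                     ≡⟨ coeff-B* i≤m ⟨
      coeff (B *) i                       ∎
      where open ≡-Reasoning

    reverse-congruent : ∀ g → deg g ≡ N → Congruent g → Close (g *)
    reverse-congruent g deg≡N cong-g j with ℕₚ.≤-<-connex j m
    ... | inj₁ j≤m = begin
      coeff (g *) ((h ℕ.+ 1) ℕ.+ j)
        ≡⟨ coeff-*-≤ g (subst ((h ℕ.+ 1) ℕ.+ j ≤_) (sym deg≡N) (ℕₚ.+-monoʳ-≤ (h ℕ.+ 1) j≤m)) ⟩
      coeff g (deg g ∸ ((h ℕ.+ 1) ℕ.+ j))    ≡⟨ cong (λ d → coeff g (d ∸ ((h ℕ.+ 1) ℕ.+ j))) deg≡N ⟩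
      coeff g (N ∸ ((h ℕ.+ 1) ℕ.+ j))        ≡⟨ cong (coeff g) (ℕₚ.[m+n]∸[m+o]≡n∸o (h ℕ.+ 1) m j) ⟩
      coeff g (m ∸ j)                        ≡⟨ cong-g (m ∸ j) (ℕₚ.m∸n≤m m j) ⟩
      coeff (B *) (m ∸ j)                    ≡⟨ coeff-B* (ℕₚ.m∸n≤m m j) ⟩
      coeff B (m ∸ (m ∸ j))                  ≡⟨ cong (coeff B) (ℕₚ.m∸[m∸n]≡n j≤m) ⟩
      coeff B j                              ∎
      where open ≡-Reasoning
    ... | inj₂ m<j = trans (coeff-*-> g (subst (_< (h ℕ.+ 1) ℕ.+ j) (sym deg≡N) (ℕₚ.+-monoʳ-< (h ℕ.+ 1) m<j)))
                           (sym (coeff-above-deg B j (subst (_< j) (sym deg-B) m<j)))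

    InInterval? : Pol → Bool
    InInterval? f = (∣ f ⊖ A ∣ ≤ᵇ q ℕ.^ h) ∧ not (isZ (at0 f))

    InProgression? : Pol → Bool
    InProgression? g = congruent g (B *) (T^ (suc m))

    interval : List Pol
    interval = filterᵇ InInterval? (monicUpTo (deg A))

    progression : List Pol
    progression = filterᵇ InProgression? (polysDeg N)

    ∈-interval⁻ : ∀ {f} → f ∈ interval → MonicT∤ f × deg f ≡ N × Close f
    ∈-interval⁻ {f} f∈ with ∈-filterᵇ⁻ InInterval? {monicUpTo (deg A)} f∈
    ... | f∈monic , t with Equivalence.to T-∧ t | ∈-monicUpTo⁻ (deg A) f∈monic
    ... | close , f₀≢0 | f-normal , lead≡1 , f≤A = monic , deg≡N , close-sound f close
      where
      monic : MonicT∤ f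
      monic = record { normal = f-normal ; lead≡1 = lead≡1
                     ; coeff₀≢0 = λ eq → T-not-isZ⁻ f₀≢0 (trans (at0≡coeff₀ f) eq) }
      top : coeff f N ≡ 1#
      top = trans (close-sound f close m) (trans (cong (coeff B) (sym deg-B)) (trans (coeff-deg B) lead-B))
      deg≡N : deg f ≡ N
      deg≡N = deg-unique f (λ i N<i → coeff-above-deg f i (ℕₚ.≤-<-trans (subst (deg f ≤_) deg-A f≤A) N<i))
                (λ eq → 1≢0 (trans (sym top) eq))

    ∈-interval⁺ : ∀ {f} → MonicT∤ f → deg f ≡ N → Close f → f ∈ interval
    ∈-interval⁺ {f} monic deg≡N close = ∈-filterᵇ⁺ InInterval?
      (∈-monicUpTo⁺ (deg A) normal lead≡1 (ℕₚ.≤-reflexive (trans deg≡N (sym deg-A))))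
      (Equivalence.from T-∧ (close-complete f close , T-not-isZ⁺ λ eq → coeff₀≢0 (trans (sym (at0≡coeff₀ f)) eq)))
      where open MonicT∤ monic

    ∈-progression⁻ : ∀ {g} → g ∈ progression → Normal g × Nonzero g × deg g ≡ N × Congruent g
    ∈-progression⁻ {g} g∈ with ∈-filterᵇ⁻ InProgression? {polysDeg N} g∈
    ... | g∈deg , t with ∈-polysDeg⁻ N g∈deg
    ... | g-normal , g≢0 , deg≡N = g-normal , g≢0 , deg≡N , congruent-sound g t

    ∈-progression⁺ : ∀ {g} → Normal g → Nonzero g → deg g ≡ N → Congruent g → g ∈ progression
    ∈-progression⁺ {g} g-normal g≢0 deg≡N cong-g =
      ∈-filterᵇ⁺ InProgression? (∈-polysDeg⁺ N g-normal g≢0 deg≡N) (congruent-complete g cong-g)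

    congruent⇒coeff₀≡1 : ∀ g → Congruent g → coeff g 0 ≡ 1#
    congruent⇒coeff₀≡1 g cong-g = trans (cong-g 0 z≤n) (trans (coeff₀-* B) lead-B)

    *-interval : ∀ {f} → f ∈ interval → f * ∈ progression
    *-interval {f} f∈ with ∈-interval⁻ f∈
    ... | monic , deg≡N , close = ∈-progression⁺ (*-normal f) (*-nonzero nonzero′)
      (trans (deg-* nonzero′ coeff₀≢0) deg≡N) (reverse-close f deg≡N close)
      where open MonicT∤ monic

    *-progression : ∀ {g} → g ∈ progression → g * ∈ interval
    *-progression {g} g∈ with ∈-progression⁻ g∈
    ... | g-normal , g≢0 , deg≡N , cong-g = ∈-interval⁺ monic (trans (deg-* g≢0 g₀≢0) deg≡N)
      (reverse-congruent g deg≡N cong-g)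
      where
      g₀≡1 = congruent⇒coeff₀≡1 g cong-g
      g₀≢0 : coeff g 0 ≢ 0#
      g₀≢0 eq = 1≢0 (trans (sym g₀≡1) eq)
      monic : MonicT∤ (g *)
      monic = record
        { normal = *-normal g ; lead≡1 = trans (lead-* g≢0 g₀≢0) g₀≡1
        ; coeff₀≢0 = λ eq → lead≢0 g≢0 (trans (sym (coeff₀-* g)) eq) }

    **-interval : ∀ {f} → f ∈ interval → (f *) * ≡ f
    **-interval {f} f∈ with ∈-interval⁻ f∈
    ... | monic , _ , _ = ≈⇒≡ (*-normal (f *)) normal (*-involutive nonzero′ coeff₀≢0)
      where open MonicT∤ monic

    **-progression : ∀ {g} → g ∈ progression → (g *) * ≡ g
    **-progression {g} g∈ with ∈-progression⁻ g∈
    ... | g-normal , g≢0 , _ , cong-g =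
      ≈⇒≡ (*-normal (g *)) g-normal (*-involutive g≢0 λ eq → 1≢0 (trans (sym (congruent⇒coeff₀≡1 g cong-g)) eq))

    Λk-* : ∀ k {f} → f ∈ interval → Λk k (f *) ≡ Λk k f
    Λk-* k f∈ with ∈-interval⁻ f∈
    ... | monic , _ , _ = trans (Λmon-ρ k monic) (cong (Λmon k) (sym (monicize-id normal lead≡1)))
      where open MonicT∤ monic

    NU≡Ψ̃ : ∀ k → NU k A h ≡ Ψ̃ k N (T^ (suc m)) (B *)
    NU≡Ψ̃ k = sumℕ-bijection (Λk k) (Λk k) _* _*
      (filterᵇ-unique InInterval? (monicUpTo-unique (deg A))) (filterᵇ-unique InProgression? (polysDeg-unique N))
      *-interval *-progression **-interval **-progression (Λk-* k)

open import Data.Nat using (ℕ; _≤_; _+_; _∸_)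

lemma7p3 : (F : FiniteField) → let open Poly F in
    (n h k : ℕ) → 2 ≤ n → h ≤ n ∸ 2 → 1 ≤ k →
    (B : Pol) → isMonic B → deg B ≡ n ∸ h ∸ 1 →
    NU k (T^ (h + 1) ⊗ B) h ≡ Ψ̃ k n (T^ (n ∸ h)) (B *)
lemma7p3 F n h k 2≤n h≤n∸2 _ B (_ , lead-B) deg-B =
  trans (NU≡Ψ̃ h m lead-B deg-B k) (cong₂ (λ N M → Ψ̃ k N (T^ M) (B *)) N≡n suc-m≡n∸h)
  where
  open Poly F using (Ψ̃; T^; _*)
  open ShortIntervals F
  m = n ∸ h ∸ 1
  h<n : h < n
  h<n = ℕₚ.<-≤-trans (ℕₚ.m<m+n h (s≤s z≤n)) (subst (h + 2 ≤_) (ℕₚ.m∸n+n≡m 2≤n) (ℕₚ.+-monoˡ-≤ 2 h≤n∸2))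
  suc-m≡n∸h : suc m ≡ n ∸ h
  suc-m≡n∸h = trans (sym (ℕₚ.+-∸-assoc 1 (ℕₚ.m<n⇒0<n∸m h<n))) (ℕₚ.m+n∸m≡n 1 (n ∸ h))
  N≡n : (h + 1) + m ≡ n
  N≡n = trans (ℕₚ.+-assoc h 1 m) (trans (cong (h +_) suc-m≡n∸h) (ℕₚ.m+[n∸m]≡n (ℕₚ.<⇒≤ h<n)))
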